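{- For every integer $m\ge2$ and every $j\in\{0,1,\dots,m\}$, $$(-1)^m\ell_{m,j}(u)=\sum_{n=j}^m(-1)^n\binom nj D^{n-j}\ell_{m,n}(u);$$ in particular $\ell_{m,m-1}(u)=\frac m2D^1\ell_{m,m}(u)$.
   Context: $D=\mathrm d/\mathrm du$ and $(\widehat\vartheta f)(u)=D[uf(u)]$. For $m\ge1$ the polynomials $\ell_{m,j}(u)$ ($0\le j\le m$) are defined by $\sum_{j=0}^m\ell_{m,j}(u)D^j=u\widehat\vartheta^m+\sum_{k=1}^{\lfloor m/2\rfloor+1}u^{1-k}\sum_{(\alpha_1,\dots,\alpha_k)}(\widehat\vartheta-k)^{m+1-\alpha_1}\prod_{n=1}^k\alpha_n(\alpha_n-m-2)(\widehat\vartheta-k+n)^{\alpha_n-\alpha_{n+1}}$, the inner sum over integer tuples with $1\le\alpha_n\le m+1$, $\alpha_{n+1}\le\alpha_n-2$ for $1\le n\le k-1$, and $\alpha_{k+1}:=1$. -}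

module Defs where

open import Data.Nat as ℕ using (ℕ; zero; suc; _∸_)
open import Data.Nat.Combinatorics using (_C_)
open import Data.Integer as ℤ using (ℤ; +_; -_)
open import Data.List using (List; []; _∷_; foldr; map; concatMap; applyUpTo)
open import Function using (_∘_)

-- Differential operators with Laurent-polynomial (integer) coefficients,
-- in normal form  Σ_j c_j(u) D^j  where  c_j(u) = Σ_e c_{j,e} u^e.
-- An operator is represented by its coefficient function  (j , e) ↦ c_{j,e}.
-- (All operators below are built from finitely many generators, so only
-- finitely many coefficients are non-zero.)
Op : Set
Op = ℕ → ℤ → ℤ

-- A Laurent polynomial in u: exponent e ↦ coefficient of u^e.
LPoly : Set
LPoly = ℤ → ℤ

oneOp : Op
oneOp zero (+ zero) = + 1
oneOp _    _        = + 0

zeroOp : Op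
zeroOp _ _ = + 0

_⊕_ : Op → Op → Op
(A ⊕ B) j e = A j e ℤ.+ B j e

_⊙_ : ℤ → Op → Op
(c ⊙ A) j e = c ℤ.* A j e

sumOp : List Op → Op
sumOp = foldr _⊕_ zeroOp

-- left multiplication by u^s  (s ∈ ℤ):  u^s · u^e D^j = u^(e+s) D^j
uPow : ℤ → Op → Op
uPow s A j e = A j (e ℤ.- s)

-- left multiplication by D:  D · u^e D^j = u^e D^(j+1) + e u^(e-1) D^j
DOp : Op → Op
DOp A zero    e = (e ℤ.+ + 1) ℤ.* A zero (e ℤ.+ + 1)
DOp A (suc j) e = A j e ℤ.+ (e ℤ.+ + 1) ℤ.* A (suc j) (e ℤ.+ + 1)

ϑOp : Op → Op
ϑOp A = DOp (uPow (+ 1) A)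

ϑShiftPow : ℤ → ℕ → Op → Op
ϑShiftPow c zero    A = A
ϑShiftPow c (suc p) A = ϑOp B ⊕ (c ⊙ B)
  where B = ϑShiftPow c p A

-- [a , a+1 , … , b]  (empty if b < a)
fromTo : ℕ → ℕ → List ℕ
fromTo a b = applyUpTo (a ℕ.+_) (suc b ∸ a)

chains : ℕ → ℕ → List (List ℕ)
chains zero    b = [] ∷ []
chains (suc k) b = concatMap (λ a → map (a ∷_) (chains k (a ∸ 2))) (fromTo 1 b)

-- For fixed m, k: left multiplication by
--   ∏_{n = n₀}^{k} α_n (α_n - m - 2) (ϑ̂ - k + n)^(α_n - α_(n+1)),
-- with the list (α_{n₀}, …, α_k) given and α_(k+1) := 1 (factors ordered
-- left to right by increasing n).
prodOp : (m k n : ℕ) → List ℕ → Op → Op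
prodOp m k n []            X = X
prodOp m k n (α ∷ [])      X =
  ((+ α) ℤ.* ((+ α) ℤ.- (+ (m ℕ.+ 2))))
    ⊙ ϑShiftPow ((+ n) ℤ.- (+ k)) (α ∸ 1) X
prodOp m k n (α ∷ β ∷ αs)  X =
  ((+ α) ℤ.* ((+ α) ℤ.- (+ (m ℕ.+ 2))))
    ⊙ ϑShiftPow ((+ n) ℤ.- (+ k)) (α ∸ β) (prodOp m k (suc n) (β ∷ αs) X)

tupleOp : (m k : ℕ) → List ℕ → Op
tupleOp m k []       = zeroOp   -- never used (k ≥ 1)
tupleOp m k (α ∷ αs) =
  ϑShiftPow (- (+ k)) (suc m ∸ α) (prodOp m k 1 (α ∷ αs) oneOp)

LOp : ℕ → Op
LOp m = uPow (+ 1) (ϑShiftPow (+ 0) m oneOp)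
      ⊕ sumOp (map (λ k → uPow ((+ 1) ℤ.- (+ k))
                                 (sumOp (map (tupleOp m k) (chains k (suc m)))))
                   (fromTo 1 (suc (m ℕ./ 2))))

ℓ : ℕ → ℕ → LPoly
ℓ m j = LOp m j

dP : LPoly → LPoly
dP p e = (e ℤ.+ + 1) ℤ.* p (e ℤ.+ + 1)

dPow : ℕ → LPoly → LPoly
dPow zero    p = p
dPow (suc n) p = dP (dPow n p)

sumℤ : List ℤ → ℤ
sumℤ = foldr ℤ._+_ (+ 0)

rhs : ℕ → ℕ → LPoly
rhs m j e = sumℤ (map (λ n → ((- (+ 1)) ℤ.^ n) ℤ.* (+ (n C j)) ℤ.* dPow (n ∸ j) (ℓ m n) e)
                      (fromTo j m))

-- The right-hand side is the coefficient of D^j in the formal adjoint L* = Σ_n (-D)^n ∘ ℓ_{m,n}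
-- of L = Σ_n ℓ_{m,n} D^n, so the identity says L* = (-1)^m L.  Taking adjoints reverses products,
-- fixes u^s and sends ϑ̂ + c to -(ϑ̂ - 1 - c), and u^s (ϑ̂ + c) = (ϑ̂ + c - s) u^s.  Hence the adjoint
-- of u ϑ̂^m is (-1)^m u ϑ̂^m, and the adjoint of the term of a tuple α, whose exponents
-- m + 1 - α_1, α_1 - α_2, …, α_k - 1 add up to m, is (-1)^m times the term of the mirrored tuple
-- (m + 2 - α_k, …, m + 2 - α_1).  That tuple is admissible again and has the same coefficient
-- ∏ α_n (α_n - m - 2), so mirroring permutes the terms of each inner sum.  For j = m - 1 only
-- n = m - 1 and n = m contribute: (-1)^m ℓ_{m,m-1} = (-1)^(m-1) ℓ_{m,m-1} + (-1)^m m D ℓ_{m,m}.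

module Submission where

open import Defs
open import Data.Nat using (ℕ; _≤_; _∸_)
open import Data.Integer using (ℤ; +_; -_; _*_; _^_)
open import Data.Rational using (ℚ; _/_) renaming (_*_ to _*ℚ_)
open import Data.Product using (_×_)
open import Relation.Binary.PropositionalEquality using (_≡_)

open import Data.Empty using (⊥-elim)
open import Data.Integer as ℤ using (_+_; _-_)
import Data.Integer.Properties as ℤP
open import Algebra.Properties.CommutativeSemigroup ℤP.*-commutativeSemigroup using (x∙yz≈y∙xz)
open import Algebra.Properties.CommutativeSemigroup ℤP.+-commutativeSemigroup using () renaming (x∙yz≈y∙xz to +-x∙yz≈y∙xz)
open import Data.Integer.Tactic.RingSolver using (solve-∀)
open import Data.List using (List; []; _∷_; map; reverse; _++_; length; concatMap; applyUpTo)
import Data.List.Properties as LP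
open import Data.List.Membership.Propositional using (_∈_; find; lose)
import Data.List.Membership.Propositional.Properties as ∈P
open import Data.List.Membership.Propositional.Properties.WithK using (unique∧set⇒bag)
open import Data.List.Relation.Binary.BagAndSetEquality using (∼bag⇒↭)
open import Data.List.Relation.Binary.Permutation.Propositional as ↭ using (_↭_)
import Data.List.Relation.Binary.Permutation.Propositional.Properties as ↭P
open import Data.List.Relation.Unary.All as All using (All; []; _∷_)
import Data.List.Relation.Unary.All.Properties as AllP
open import Data.List.Relation.Unary.AllPairs using ([]; _∷_)
open import Data.List.Relation.Unary.Any using (here; there)
open import Data.List.Relation.Unary.Unique.Propositional using (Unique)
import Data.List.Relation.Unary.Unique.Propositional.Properties as Unique
open import Data.Nat as ℕ using (zero; suc; z≤n; s≤s; _<_)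
open import Data.Nat.Combinatorics using (_C_; nCk≡nC[n∸k]; nCn≡1; nCk+nC[k+1]≡[n+1]C[k+1])
open import Data.Nat.Combinatorics.Specification using (k>n⇒nCk≡0)
import Data.Nat.Properties as ℕP
open import Data.Nat.Tactic.RingSolver using () renaming (solve-∀ to ℕ-solve-∀)
open import Data.Product using (_,_; proj₁; proj₂)
open import Data.Rational using (toℚᵘ)
import Data.Rational.Properties as ℚP
import Data.Rational.Unnormalised as ℚᵘ
open import Data.Rational.Unnormalised using (mkℚᵘ; *≡*)
import Data.Rational.Unnormalised.Properties as ℚᵘP
open import Data.Unit using (⊤; tt)
open import Function.Bundles using (mk⇔)
open import Relation.Binary.Bundles using (Setoid)
open import Relation.Binary.Definitions using (tri<; tri≈; tri>)
open import Relation.Binary.PropositionalEquality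
import Relation.Binary.Reasoning.Setoid as SetoidReasoning
open import Relation.Nullary using (yes; no; ¬_)

-- Operators and the operations ϑ̂, u^s and · u D on them

infix 4 _≈_
_≈_ : Op → Op → Set
A ≈ B = ∀ j e → A j e ≡ B j e

≈-refl : ∀ {A} → A ≈ A
≈-refl j e = refl

≈-sym : ∀ {A B} → A ≈ B → B ≈ A
≈-sym h j e = sym (h j e)

≈-trans : ∀ {A B C} → A ≈ B → B ≈ C → A ≈ C
≈-trans h g j e = trans (h j e) (g j e)

≈-reflexive : ∀ {A B} → A ≡ B → A ≈ B
≈-reflexive refl = ≈-refl

Op-setoid : Setoid _ _
Op-setoid = record
  { Carrier = Op
  ; _≈_ = _≈_
  ; isEquivalence = record { refl = ≈-refl ; sym = ≈-sym ; trans = ≈-trans }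
  }

module ≈-Reasoning = SetoidReasoning Op-setoid

⊕-cong : ∀ {A B C D} → A ≈ B → C ≈ D → (A ⊕ C) ≈ (B ⊕ D)
⊕-cong h g j e = cong₂ _+_ (h j e) (g j e)

⊙-cong : ∀ c {A B} → A ≈ B → (c ⊙ A) ≈ (c ⊙ B)
⊙-cong c h j e = cong (c *_) (h j e)

⊙-assoc : ∀ c d A → (c ⊙ (d ⊙ A)) ≈ ((c * d) ⊙ A)
⊙-assoc c d A j e = sym (ℤP.*-assoc c d (A j e))

⊙-identity : ∀ A → ((+ 1) ⊙ A) ≈ A
⊙-identity A j e = ℤP.*-identityˡ (A j e)

e+1-1≡e : ∀ e → e + + 1 - + 1 ≡ e
e+1-1≡e = solve-∀

ϑOp-zero : ∀ A e → ϑOp A zero e ≡ (e + + 1) * A zero e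
ϑOp-zero A e = cong (λ x → (e + + 1) * A zero x) (e+1-1≡e e)

ϑOp-suc : ∀ A j e → ϑOp A (suc j) e ≡ A j (e - + 1) + (e + + 1) * A (suc j) e
ϑOp-suc A j e = cong (λ x → A j (e - + 1) + (e + + 1) * A (suc j) x) (e+1-1≡e e)

ϑOp-cong : ∀ {A B} → A ≈ B → ϑOp A ≈ ϑOp B
ϑOp-cong {A} {B} h zero e = begin
  ϑOp A zero e          ≡⟨ ϑOp-zero A e ⟩
  (e + + 1) * A zero e  ≡⟨ cong ((e + + 1) *_) (h zero e) ⟩
  (e + + 1) * B zero e  ≡⟨ ϑOp-zero B e ⟨
  ϑOp B zero e          ∎
  where open ≡-Reasoning
ϑOp-cong {A} {B} h (suc j) e = begin
  ϑOp A (suc j) e                                 ≡⟨ ϑOp-suc A j e ⟩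
  A j (e - + 1) + (e + + 1) * A (suc j) e         ≡⟨ cong₂ (λ x y → x + (e + + 1) * y) (h j (e - + 1)) (h (suc j) e) ⟩
  B j (e - + 1) + (e + + 1) * B (suc j) e         ≡⟨ ϑOp-suc B j e ⟨
  ϑOp B (suc j) e                                 ∎
  where open ≡-Reasoning

ϑOp-⊕ : ∀ A B → ϑOp (A ⊕ B) ≈ (ϑOp A ⊕ ϑOp B)
ϑOp-⊕ A B zero e = begin
  ϑOp (A ⊕ B) zero e                         ≡⟨ ϑOp-zero (A ⊕ B) e ⟩
  (e + + 1) * (A zero e + B zero e)          ≡⟨ ℤP.*-distribˡ-+ (e + + 1) (A zero e) (B zero e) ⟩
  (e + + 1) * A zero e + (e + + 1) * B zero e ≡⟨ cong₂ _+_ (ϑOp-zero A e) (ϑOp-zero B e) ⟨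
  ϑOp A zero e + ϑOp B zero e                ∎
  where open ≡-Reasoning
ϑOp-⊕ A B (suc j) e = begin
  ϑOp (A ⊕ B) (suc j) e
    ≡⟨ ϑOp-suc (A ⊕ B) j e ⟩
  (A j (e - + 1) + B j (e - + 1)) + (e + + 1) * (A (suc j) e + B (suc j) e)
    ≡⟨ regroup (e + + 1) (A j (e - + 1)) (B j (e - + 1)) (A (suc j) e) (B (suc j) e) ⟩
  (A j (e - + 1) + (e + + 1) * A (suc j) e) + (B j (e - + 1) + (e + + 1) * B (suc j) e)
    ≡⟨ cong₂ _+_ (ϑOp-suc A j e) (ϑOp-suc B j e) ⟨
  ϑOp A (suc j) e + ϑOp B (suc j) e
    ∎
  where open ≡-Reasoning
        regroup : ∀ x a b c d → (a + b) + x * (c + d) ≡ (a + x * c) + (b + x * d)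
        regroup = solve-∀

ϑOp-⊙ : ∀ c A → ϑOp (c ⊙ A) ≈ (c ⊙ ϑOp A)
ϑOp-⊙ c A zero e = begin
  ϑOp (c ⊙ A) zero e        ≡⟨ ϑOp-zero (c ⊙ A) e ⟩
  (e + + 1) * (c * A zero e) ≡⟨ x∙yz≈y∙xz (e + + 1) c (A zero e) ⟩
  c * ((e + + 1) * A zero e) ≡⟨ cong (c *_) (ϑOp-zero A e) ⟨
  c * ϑOp A zero e          ∎
  where open ≡-Reasoning
ϑOp-⊙ c A (suc j) e = begin
  ϑOp (c ⊙ A) (suc j) e
    ≡⟨ ϑOp-suc (c ⊙ A) j e ⟩
  c * A j (e - + 1) + (e + + 1) * (c * A (suc j) e)
    ≡⟨ cong (λ z → c * A j (e - + 1) + z) (x∙yz≈y∙xz (e + + 1) c (A (suc j) e)) ⟩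
  c * A j (e - + 1) + c * ((e + + 1) * A (suc j) e)
    ≡⟨ ℤP.*-distribˡ-+ c (A j (e - + 1)) _ ⟨
  c * (A j (e - + 1) + (e + + 1) * A (suc j) e)
    ≡⟨ cong (c *_) (ϑOp-suc A j e) ⟨
  c * ϑOp A (suc j) e
    ∎
  where open ≡-Reasoning

ϑShift : ℤ → Op → Op
ϑShift c A = ϑOp A ⊕ (c ⊙ A)

ϑShift-cong : ∀ c {A B} → A ≈ B → ϑShift c A ≈ ϑShift c B
ϑShift-cong c h = ⊕-cong (ϑOp-cong h) (⊙-cong c h)

record ϑLinear (F : Op → Op) : Set where
  field
    ≈-cong   : ∀ {A B} → A ≈ B → F A ≈ F B
    ⊕-homo   : ∀ A B → F (A ⊕ B) ≈ (F A ⊕ F B)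
    ⊙-homo   : ∀ c A → F (c ⊙ A) ≈ (c ⊙ F A)
    ϑOp-comm : ∀ A → F (ϑOp A) ≈ ϑOp (F A)

  ϑShift-comm : ∀ c A → F (ϑShift c A) ≈ ϑShift c (F A)
  ϑShift-comm c A = ≈-trans (⊕-homo _ _) (⊕-cong (ϑOp-comm A) (⊙-homo c A))

  ϑShiftPow-comm : ∀ c p A → F (ϑShiftPow c p A) ≈ ϑShiftPow c p (F A)
  ϑShiftPow-comm c zero    A = ≈-refl
  ϑShiftPow-comm c (suc p) A = ≈-trans (ϑShift-comm c _) (ϑShift-cong c (ϑShiftPow-comm c p A))

open ϑLinear public

id-ϑLinear : ϑLinear (λ X → X)
id-ϑLinear = record
  { ≈-cong = λ h → h ; ⊕-homo = λ _ _ → ≈-refl ; ⊙-homo = λ _ _ → ≈-refl ; ϑOp-comm = λ _ → ≈-refl }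

∘-ϑLinear : ∀ {F G} → ϑLinear F → ϑLinear G → ϑLinear (λ X → F (G X))
∘-ϑLinear LF LG = record
  { ≈-cong   = λ h → ≈-cong LF (≈-cong LG h)
  ; ⊕-homo   = λ A B → ≈-trans (≈-cong LF (⊕-homo LG A B)) (⊕-homo LF _ _)
  ; ⊙-homo   = λ c A → ≈-trans (≈-cong LF (⊙-homo LG c A)) (⊙-homo LF c _)
  ; ϑOp-comm = λ A → ≈-trans (≈-cong LF (ϑOp-comm LG A)) (ϑOp-comm LF _)
  }

ϑOp-ϑLinear : ϑLinear ϑOp
ϑOp-ϑLinear = record
  { ≈-cong = ϑOp-cong ; ⊕-homo = ϑOp-⊕ ; ⊙-homo = ϑOp-⊙ ; ϑOp-comm = λ _ → ≈-refl }

⊙-ϑLinear : ∀ d → ϑLinear (d ⊙_)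
⊙-ϑLinear d = record
  { ≈-cong   = ⊙-cong d
  ; ⊕-homo   = λ A B j e → ℤP.*-distribˡ-+ d (A j e) (B j e)
  ; ⊙-homo   = λ c A j e → x∙yz≈y∙xz d c (A j e)
  ; ϑOp-comm = λ A → ≈-sym (ϑOp-⊙ d A)
  }

⊕-ϑLinear : ∀ {F G} → ϑLinear F → ϑLinear G → ϑLinear (λ X → F X ⊕ G X)
⊕-ϑLinear {F} {G} LF LG = record
  { ≈-cong   = λ h → ⊕-cong (≈-cong LF h) (≈-cong LG h)
  ; ⊕-homo   = λ A B j e → trans (cong₂ _+_ (⊕-homo LF A B j e) (⊕-homo LG A B j e))
                                   (interchange (F A j e) (F B j e) (G A j e) (G B j e))
  ; ⊙-homo   = λ c A j e → trans (cong₂ _+_ (⊙-homo LF c A j e) (⊙-homo LG c A j e))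
                                   (sym (ℤP.*-distribˡ-+ c (F A j e) (G A j e)))
  ; ϑOp-comm = λ A → ≈-trans (⊕-cong (ϑOp-comm LF A) (ϑOp-comm LG A)) (≈-sym (ϑOp-⊕ (F A) (G A)))
  }
  where interchange : ∀ a b c d → (a + b) + (c + d) ≡ (a + c) + (b + d)
        interchange = solve-∀

ϑShift-ϑLinear : ∀ c → ϑLinear (ϑShift c)
ϑShift-ϑLinear c = ⊕-ϑLinear ϑOp-ϑLinear (⊙-ϑLinear c)

ϑShiftPow-ϑLinear : ∀ c p → ϑLinear (ϑShiftPow c p)
ϑShiftPow-ϑLinear c zero    = id-ϑLinear
ϑShiftPow-ϑLinear c (suc p) = ∘-ϑLinear (ϑShift-ϑLinear c) (ϑShiftPow-ϑLinear c p)

uPow-cong : ∀ s {A B} → A ≈ B → uPow s A ≈ uPow s B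
uPow-cong s h j e = h j (e - s)

uPow-ϑOp : ∀ s A → uPow s (ϑOp A) ≈ ϑShift (- s) (uPow s A)
uPow-ϑOp s A zero e = begin
  ϑOp A zero (e - s)                                   ≡⟨ ϑOp-zero A (e - s) ⟩
  (e - s + + 1) * A zero (e - s)                       ≡⟨ split e s (A zero (e - s)) ⟩
  (e + + 1) * A zero (e - s) + (- s) * A zero (e - s)  ≡⟨ cong (_+ (- s) * A zero (e - s)) (ϑOp-zero (uPow s A) e) ⟨
  ϑShift (- s) (uPow s A) zero e                       ∎
  where open ≡-Reasoning
        split : ∀ e s a → (e - s + + 1) * a ≡ (e + + 1) * a + (- s) * a
        split = solve-∀
uPow-ϑOp s A (suc j) e = begin
  ϑOp A (suc j) (e - s)
    ≡⟨ ϑOp-suc A j (e - s) ⟩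
  A j (e - s - + 1) + (e - s + + 1) * A (suc j) (e - s)
    ≡⟨ cong (λ x → A j x + (e - s + + 1) * A (suc j) (e - s)) (swap e s) ⟩
  A j (e - + 1 - s) + (e - s + + 1) * A (suc j) (e - s)
    ≡⟨ split e s (A j (e - + 1 - s)) (A (suc j) (e - s)) ⟩
  (A j (e - + 1 - s) + (e + + 1) * A (suc j) (e - s)) + (- s) * A (suc j) (e - s)
    ≡⟨ cong (_+ (- s) * A (suc j) (e - s)) (ϑOp-suc (uPow s A) j e) ⟨
  ϑShift (- s) (uPow s A) (suc j) e
    ∎
  where open ≡-Reasoning
        swap : ∀ e s → e - s - + 1 ≡ e - + 1 - s
        swap = solve-∀
        split : ∀ e s a b → a + (e - s + + 1) * b ≡ (a + (e + + 1) * b) + (- s) * b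
        split = solve-∀

uPow-ϑShift : ∀ s c A → uPow s (ϑShift c A) ≈ ϑShift (c - s) (uPow s A)
uPow-ϑShift s c A j e =
  trans (cong (_+ c * A j (e - s)) (uPow-ϑOp s A j e)) (merge (ϑOp (uPow s A) j e) s c (A j (e - s)))
  where merge : ∀ x s c a → (x + (- s) * a) + c * a ≡ x + (c - s) * a
        merge = solve-∀

uPow-ϑShiftPow : ∀ s c p A → uPow s (ϑShiftPow c p A) ≈ ϑShiftPow (c - s) p (uPow s A)
uPow-ϑShiftPow s c zero    A = ≈-refl
uPow-ϑShiftPow s c (suc p) A =
  ≈-trans (uPow-ϑShift s c (ϑShiftPow c p A)) (ϑShift-cong (c - s) (uPow-ϑShiftPow s c p A))

-- right multiplication by u D:  b u^e D^j · u D = b u^(e+1) D^(j+1) + j b u^e D^j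
_·uD : Op → Op
(B ·uD) zero    e = + 0
(B ·uD) (suc j) e = B j (e - + 1) + (+ suc j) * B (suc j) e

·uD-ϑLinear : ϑLinear _·uD
·uD-ϑLinear = record { ≈-cong = ·uD-cong ; ⊕-homo = ·uD-⊕ ; ⊙-homo = ·uD-⊙ ; ϑOp-comm = ·uD-ϑOp }
  where
    ·uD-cong : ∀ {A B} → A ≈ B → (A ·uD) ≈ (B ·uD)
    ·uD-cong h zero    e = refl
    ·uD-cong h (suc j) e = cong₂ (λ x y → x + (+ suc j) * y) (h j (e - + 1)) (h (suc j) e)

    ·uD-⊕ : ∀ A B → ((A ⊕ B) ·uD) ≈ ((A ·uD) ⊕ (B ·uD))
    ·uD-⊕ A B zero    e = refl
    ·uD-⊕ A B (suc j) e = regroup (A j (e - + 1)) (B j (e - + 1)) (+ suc j) (A (suc j) e) (B (suc j) e)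
      where regroup : ∀ a b n c d → (a + b) + n * (c + d) ≡ (a + n * c) + (b + n * d)
            regroup = solve-∀

    ·uD-⊙ : ∀ c A → ((c ⊙ A) ·uD) ≈ (c ⊙ (A ·uD))
    ·uD-⊙ c A zero    e = sym (ℤP.*-zeroʳ c)
    ·uD-⊙ c A (suc j) e = factor c (A j (e - + 1)) (+ suc j) (A (suc j) e)
      where factor : ∀ c a n b → c * a + n * (c * b) ≡ c * (a + n * b)
            factor = solve-∀

    ·uD-ϑOp : ∀ A → (ϑOp A ·uD) ≈ ϑOp (A ·uD)
    ·uD-ϑOp A zero e = sym (trans (ϑOp-zero (A ·uD) e) (ℤP.*-zeroʳ (e + + 1)))
    ·uD-ϑOp A (suc zero) e = begin
      ϑOp A zero (e - + 1) + + 1 * ϑOp A 1 e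
        ≡⟨ cong₂ (λ x y → x + + 1 * y) (ϑOp-zero A (e - + 1)) (ϑOp-suc A 0 e) ⟩
      (e - + 1 + + 1) * a + + 1 * (a + (e + + 1) * b)
        ≡⟨ commute e a b ⟩
      + 0 + (e + + 1) * (a + + 1 * b)
        ≡⟨ ϑOp-suc (A ·uD) 0 e ⟨
      ϑOp (A ·uD) 1 e
        ∎
      where open ≡-Reasoning
            a = A zero (e - + 1)
            b = A 1 e
            commute : ∀ e a b → (e - + 1 + + 1) * a + + 1 * (a + (e + + 1) * b) ≡ + 0 + (e + + 1) * (a + + 1 * b)
            commute = solve-∀
    ·uD-ϑOp A (suc (suc j)) e = begin
      ϑOp A (suc j) (e - + 1) + (+ suc (suc j)) * ϑOp A (suc (suc j)) e
        ≡⟨ cong₂ (λ x y → x + (+ suc (suc j)) * y) (ϑOp-suc A j (e - + 1)) (ϑOp-suc A (suc j) e) ⟩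
      (a + (e - + 1 + + 1) * b) + (+ 1 + (+ 1 + + j)) * (b + (e + + 1) * c)
        ≡⟨ commute e (+ j) a b c ⟩
      (a + (+ 1 + + j) * b) + (e + + 1) * (b + (+ 1 + (+ 1 + + j)) * c)
        ≡⟨ ϑOp-suc (A ·uD) (suc j) e ⟨
      ϑOp (A ·uD) (suc (suc j)) e
        ∎
      where open ≡-Reasoning
            a = A j (e - + 1 - + 1)
            b = A (suc j) (e - + 1)
            c = A (suc (suc j)) e
            commute : ∀ e n a b c → (a + (e - + 1 + + 1) * b) + (+ 1 + (+ 1 + n)) * (b + (e + + 1) * c)
                                  ≡ (a + (+ 1 + n) * b) + (e + + 1) * (b + (+ 1 + (+ 1 + n)) * c)
            commute = solve-∀

monomial : ℤ → Op
monomial s = uPow s oneOp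

monomial-·uD : ∀ s → (monomial s ·uD) ≈ ϑShift (- (+ 1 + s)) (monomial s)
monomial-·uD s zero e = sym (begin
  ϑOp (monomial s) zero e + (- (+ 1 + s)) * o   ≡⟨ cong (_+ (- (+ 1 + s)) * o) (ϑOp-zero (monomial s) e) ⟩
  (e + + 1) * o + (- (+ 1 + s)) * o             ≡⟨ collect e s o ⟩
  (e - s) * oneOp zero (e - s)                  ≡⟨ vanish (e - s) ⟩
  + 0                                           ∎)
  where open ≡-Reasoning
        o = oneOp zero (e - s)
        collect : ∀ e s o → (e + + 1) * o + (- (+ 1 + s)) * o ≡ (e - s) * o
        collect = solve-∀
        vanish : ∀ x → x * oneOp zero x ≡ + 0
        vanish (+ zero)     = refl
        vanish (+ suc n)    = ℤP.*-zeroʳ (+ suc n)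
        vanish ℤ.-[1+ n ]   = ℤP.*-zeroʳ ℤ.-[1+ n ]
monomial-·uD s (suc j) e =
  sym (trans (cong (_+ (- (+ 1 + s)) * + 0) (ϑOp-suc (monomial s) j e))
             (zeros (oneOp j (e - + 1 - s)) (e + + 1) (- (+ 1 + s)) (+ suc j)))
  where zeros : ∀ o x y n → (o + x * + 0) + y * + 0 ≡ o + n * + 0
        zeros = solve-∀

Order< : ℕ → Op → Set
Order< K A = ∀ n e → K ≤ n → A n e ≡ + 0

Order<-cong : ∀ {K A B} → A ≈ B → Order< K A → Order< K B
Order<-cong h z n e k = trans (sym (h n e)) (z n e k)

Order<-mono : ∀ {K L A} → K ≤ L → Order< K A → Order< L A
Order<-mono K≤L z n e L≤n = z n e (ℕP.≤-trans K≤L L≤n)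

Order<-ϑOp : ∀ {K A} → Order< K A → Order< (suc K) (ϑOp A)
Order<-ϑOp {K} {A} z (suc n) e (s≤s K≤n) = begin
  ϑOp A (suc n) e                          ≡⟨ ϑOp-suc A n e ⟩
  A n (e - + 1) + (e + + 1) * A (suc n) e  ≡⟨ cong₂ (λ x y → x + (e + + 1) * y) (z n (e - + 1) K≤n) (z (suc n) e (ℕP.m≤n⇒m≤1+n K≤n)) ⟩
  + 0 + (e + + 1) * + 0                    ≡⟨ cong (λ x → + 0 + x) (ℤP.*-zeroʳ (e + + 1)) ⟩
  + 0                                      ∎
  where open ≡-Reasoning

Order<-⊕ : ∀ {K A B} → Order< K A → Order< K B → Order< K (A ⊕ B)
Order<-⊕ zA zB n e k = cong₂ _+_ (zA n e k) (zB n e k)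

Order<-⊙ : ∀ {K} c {A} → Order< K A → Order< K (c ⊙ A)
Order<-⊙ c zA n e k = trans (cong (c *_) (zA n e k)) (ℤP.*-zeroʳ c)

Order<-ϑShift : ∀ {K} c {A} → Order< K A → Order< (suc K) (ϑShift c A)
Order<-ϑShift c zA = Order<-⊕ (Order<-ϑOp zA) (Order<-⊙ c (Order<-mono (ℕP.n≤1+n _) zA))

Order<-monomial : ∀ s → Order< 1 (monomial s)
Order<-monomial s (suc n) e _ = refl

Order<-zeroOp : ∀ K → Order< K zeroOp
Order<-zeroOp K n e _ = refl

-- Binomial coefficients, finite sums and derivatives of Laurent polynomials

-- Unlike _C_, this computes by pattern matching; binom≡C relates the two.
binom : ℕ → ℕ → ℕ
binom _       zero    = 1
binom zero    (suc k) = 0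
binom (suc n) (suc k) = binom n k ℕ.+ binom n (suc k)

binom≡C : ∀ n k → binom n k ≡ n C k
binom≡C n       zero    = sym (trans (nCk≡nC[n∸k] {0} {n} z≤n) (nCn≡1 n))
binom≡C zero    (suc k) = sym (k>n⇒nCk≡0 {0} {suc k} (s≤s z≤n))
binom≡C (suc n) (suc k) = trans (cong₂ ℕ._+_ (binom≡C n k) (binom≡C n (suc k))) (nCk+nC[k+1]≡[n+1]C[k+1] n k)

binom-> : ∀ n k → n < k → binom n k ≡ 0
binom-> zero    (suc k) _         = refl
binom-> (suc n) (suc k) (s≤s n<k) = cong₂ ℕ._+_ (binom-> n k n<k) (binom-> n (suc k) (ℕP.m<n⇒m<1+n n<k))

binom-n-1 : ∀ n → binom n 1 ≡ n
binom-n-1 zero    = refl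
binom-n-1 (suc n) = cong suc (binom-n-1 n)

binom-n-n : ∀ n → binom n n ≡ 1
binom-n-n zero    = refl
binom-n-n (suc n) = cong₂ ℕ._+_ (binom-n-n n) (binom-> n (suc n) (ℕP.n<1+n n))

binom-absorb : ∀ n k → suc k ℕ.* binom (suc n) (suc k) ≡ suc n ℕ.* binom n k
binom-absorb zero    zero    = refl
binom-absorb zero    (suc k) = ℕP.*-zeroʳ (suc (suc k))
binom-absorb (suc n) zero    = trans (ℕP.*-identityˡ _) (trans (binom-n-1 (suc (suc n))) (sym (ℕP.*-identityʳ (suc (suc n)))))
binom-absorb (suc n) (suc k) = begin
  suc (suc k) ℕ.* (binom (suc n) (suc k) ℕ.+ binom (suc n) (suc (suc k)))
    ≡⟨ ℕP.*-distribˡ-+ (suc (suc k)) (binom (suc n) (suc k)) _ ⟩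
  suc (suc k) ℕ.* binom (suc n) (suc k) ℕ.+ suc (suc k) ℕ.* binom (suc n) (suc (suc k))
    ≡⟨ cong₂ (λ x y → (binom (suc n) (suc k) ℕ.+ x) ℕ.+ y) (binom-absorb n k) (binom-absorb n (suc k)) ⟩
  (binom (suc n) (suc k) ℕ.+ suc n ℕ.* binom n k) ℕ.+ suc n ℕ.* binom n (suc k)
    ≡⟨ regroup (binom (suc n) (suc k)) (suc n) (binom n k) (binom n (suc k)) ⟩
  binom (suc n) (suc k) ℕ.+ suc n ℕ.* (binom n k ℕ.+ binom n (suc k))
    ∎
  where open ≡-Reasoning
        regroup : ∀ b n x y → (b ℕ.+ n ℕ.* x) ℕ.+ n ℕ.* y ≡ b ℕ.+ n ℕ.* (x ℕ.+ y)
        regroup = ℕ-solve-∀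

binom-sym : ∀ a b → binom (a ℕ.+ b) a ≡ binom (a ℕ.+ b) b
binom-sym zero    zero    = refl
binom-sym zero    (suc b) = sym (binom-n-n (suc b))
binom-sym (suc a) zero    = trans (cong (λ x → binom x (suc a)) (ℕP.+-identityʳ (suc a))) (binom-n-n (suc a))
binom-sym (suc a) (suc b) = begin
  binom (a ℕ.+ suc b) a ℕ.+ binom (a ℕ.+ suc b) (suc a)
    ≡⟨ cong₂ ℕ._+_ (binom-sym a (suc b)) (cong (λ x → binom x (suc a)) (ℕP.+-suc a b)) ⟩
  binom (a ℕ.+ suc b) (suc b) ℕ.+ binom (suc a ℕ.+ b) (suc a)
    ≡⟨ cong (binom (a ℕ.+ suc b) (suc b) ℕ.+_) (trans (binom-sym (suc a) b) (cong (λ x → binom x b) (sym (ℕP.+-suc a b)))) ⟩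
  binom (a ℕ.+ suc b) (suc b) ℕ.+ binom (a ℕ.+ suc b) b
    ≡⟨ ℕP.+-comm _ (binom (a ℕ.+ suc b) b) ⟩
  binom (a ℕ.+ suc b) b ℕ.+ binom (a ℕ.+ suc b) (suc b)
    ∎
  where open ≡-Reasoning

binom-[1+n]-n : ∀ n → binom (suc n) n ≡ suc n
binom-[1+n]-n n = begin
  binom (suc n) n      ≡⟨ cong (λ x → binom x n) (ℕP.+-comm 1 n) ⟩
  binom (n ℕ.+ 1) n    ≡⟨ binom-sym n 1 ⟩
  binom (n ℕ.+ 1) 1    ≡⟨ cong (λ x → binom x 1) (ℕP.+-comm n 1) ⟩
  binom (suc n) 1      ≡⟨ binom-n-1 (suc n) ⟩
  suc n                ∎
  where open ≡-Reasoning

binom-lower-step : ∀ j i → binom (suc (j ℕ.+ i)) j ℕ.* suc i ≡ suc j ℕ.* binom (suc (j ℕ.+ i)) (suc j)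
binom-lower-step j i = begin
  binom (suc (j ℕ.+ i)) j ℕ.* suc i
    ≡⟨ cong (λ x → binom x j ℕ.* suc i) (sym (ℕP.+-suc j i)) ⟩
  binom (j ℕ.+ suc i) j ℕ.* suc i
    ≡⟨ cong (ℕ._* suc i) (binom-sym j (suc i)) ⟩
  binom (j ℕ.+ suc i) (suc i) ℕ.* suc i
    ≡⟨ cong (λ x → binom x (suc i) ℕ.* suc i) (trans (ℕP.+-suc j i) (cong suc (ℕP.+-comm j i))) ⟩
  binom (suc (i ℕ.+ j)) (suc i) ℕ.* suc i
    ≡⟨ ℕP.*-comm _ (suc i) ⟩
  suc i ℕ.* binom (suc (i ℕ.+ j)) (suc i)
    ≡⟨ binom-absorb (i ℕ.+ j) i ⟩
  suc (i ℕ.+ j) ℕ.* binom (i ℕ.+ j) i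
    ≡⟨ cong (suc (i ℕ.+ j) ℕ.*_) (binom-sym i j) ⟩
  suc (i ℕ.+ j) ℕ.* binom (i ℕ.+ j) j
    ≡⟨ cong (λ x → suc x ℕ.* binom x j) (ℕP.+-comm i j) ⟩
  suc (j ℕ.+ i) ℕ.* binom (j ℕ.+ i) j
    ≡⟨ binom-absorb (j ℕ.+ i) j ⟨
  suc j ℕ.* binom (suc (j ℕ.+ i)) (suc j)
    ∎
  where open ≡-Reasoning

sumTo : ℕ → (ℕ → ℤ) → ℤ
sumTo zero    f = + 0
sumTo (suc K) f = f 0 + sumTo K (λ i → f (suc i))

sumTo-cong : ∀ K {f g} → (∀ i → f i ≡ g i) → sumTo K f ≡ sumTo K g
sumTo-cong zero    h = refl
sumTo-cong (suc K) h = cong₂ _+_ (h 0) (sumTo-cong K (λ i → h (suc i)))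

sumTo-+ : ∀ K f g → sumTo K (λ i → f i + g i) ≡ sumTo K f + sumTo K g
sumTo-+ zero    f g = refl
sumTo-+ (suc K) f g = trans (cong (λ z → (f 0 + g 0) + z) (sumTo-+ K _ _))
                            (interchange (f 0) (g 0) (sumTo K (λ i → f (suc i))) (sumTo K (λ i → g (suc i))))
  where interchange : ∀ a b c d → a + b + (c + d) ≡ (a + c) + (b + d)
        interchange = solve-∀

sumTo-* : ∀ K c f → sumTo K (λ i → c * f i) ≡ c * sumTo K f
sumTo-* zero    c f = sym (ℤP.*-zeroʳ c)
sumTo-* (suc K) c f = trans (cong (λ z → c * f 0 + z) (sumTo-* K c _)) (sym (ℤP.*-distribˡ-+ c (f 0) _))

sumTo-neg : ∀ K f → sumTo K (λ i → - f i) ≡ - sumTo K f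
sumTo-neg zero    f = refl
sumTo-neg (suc K) f = trans (cong (λ z → - f 0 + z) (sumTo-neg K _)) (sym (ℤP.neg-distrib-+ (f 0) _))

sumTo-zero : ∀ K f → (∀ i → f i ≡ + 0) → sumTo K f ≡ + 0
sumTo-zero zero    f h = refl
sumTo-zero (suc K) f h = cong₂ _+_ (h 0) (sumTo-zero K _ (λ i → h (suc i)))

sumTo-snoc : ∀ K f → sumTo (suc K) f ≡ sumTo K f + f K
sumTo-snoc zero    f = ℤP.+-comm (f 0) (+ 0)
sumTo-snoc (suc K) f = trans (cong (λ z → f 0 + z) (sumTo-snoc K (λ i → f (suc i)))) (sym (ℤP.+-assoc (f 0) _ _))

sumTo-extend : ∀ K L f → (∀ i → K ≤ i → f i ≡ + 0) → K ≤ L → sumTo L f ≡ sumTo K f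
sumTo-extend K L f h K≤L = trans (cong (λ x → sumTo x f) (sym (ℕP.m∸n+n≡m K≤L))) (pad (L ∸ K))
  where
    pad : ∀ d → sumTo (d ℕ.+ K) f ≡ sumTo K f
    pad zero    = refl
    pad (suc d) = trans (sumTo-snoc (d ℕ.+ K) f)
                        (trans (cong₂ _+_ (pad d) (h (d ℕ.+ K) (ℕP.m≤n+m K d))) (ℤP.+-identityʳ _))

sumTo-telescope : ∀ K V → sumTo K (λ i → V (suc i) - V i) ≡ V K - V 0
sumTo-telescope zero    V = sym (ℤP.+-inverseʳ (V 0))
sumTo-telescope (suc K) V = trans (cong (λ z → (V 1 - V 0) + z) (sumTo-telescope K (λ i → V (suc i))))
                                  (cancel (V 0) (V 1) (V (suc K)))
  where cancel : ∀ a b c → b - a + (c - b) ≡ c - a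
        cancel = solve-∀

sumℤ-applyUpTo : ∀ K (f : ℕ → ℤ) h → sumℤ (map f (applyUpTo h K)) ≡ sumTo K (λ i → f (h i))
sumℤ-applyUpTo zero    f h = refl
sumℤ-applyUpTo (suc K) f h = cong (λ z → f (h 0) + z) (sumℤ-applyUpTo K f (λ i → h (suc i)))

uMul : LPoly → LPoly
uMul p e = p (e - + 1)

dP-cong : ∀ {p q} → (∀ e → p e ≡ q e) → ∀ e → dP p e ≡ dP q e
dP-cong h e = cong ((e + + 1) *_) (h (e + + 1))

dPow-cong : ∀ i {p q} → (∀ e → p e ≡ q e) → ∀ e → dPow i p e ≡ dPow i q e
dPow-cong zero    h = h
dPow-cong (suc i) h = dP-cong (dPow-cong i h)

dPow-+ : ∀ i p q e → dPow i (λ x → p x + q x) e ≡ dPow i p e + dPow i q e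
dPow-+ zero    p q e = refl
dPow-+ (suc i) p q e = trans (cong ((e + + 1) *_) (dPow-+ i p q (e + + 1))) (ℤP.*-distribˡ-+ (e + + 1) _ _)

dPow-* : ∀ i c p e → dPow i (λ x → c * p x) e ≡ c * dPow i p e
dPow-* zero    c p e = refl
dPow-* (suc i) c p e = trans (cong ((e + + 1) *_) (dPow-* i c p (e + + 1))) (x∙yz≈y∙xz (e + + 1) c _)

dPow-zero : ∀ i p → (∀ e → p e ≡ + 0) → ∀ e → dPow i p e ≡ + 0
dPow-zero zero    p h e = h e
dPow-zero (suc i) p h e = trans (cong ((e + + 1) *_) (dPow-zero i p h (e + + 1))) (ℤP.*-zeroʳ (e + + 1))

dPow-dP : ∀ i p e → dPow i (dP p) e ≡ dPow (suc i) p e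
dPow-dP zero    p e = refl
dPow-dP (suc i) p e = cong ((e + + 1) *_) (dPow-dP i p (e + + 1))

dP-uMul : ∀ p e → dP (uMul p) e ≡ uMul (dP p) e + p e
dP-uMul p e = begin
  (e + + 1) * p (e + + 1 - + 1)    ≡⟨ cong (λ x → (e + + 1) * p x) (e+1-1≡e e) ⟩
  (e + + 1) * p e                  ≡⟨ expand e (p e) ⟩
  e * p e + p e                    ≡⟨ cong (λ x → x * p x + p e) (cancel e) ⟨
  uMul (dP p) e + p e              ∎
  where open ≡-Reasoning
        cancel : ∀ e → e - + 1 + + 1 ≡ e
        cancel = solve-∀
        expand : ∀ e a → (e + + 1) * a ≡ e * a + a
        expand = solve-∀

dPow-uMul : ∀ i p e → dPow (suc i) (uMul p) e ≡ uMul (dPow (suc i) p) e + (+ suc i) * dPow i p e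
dPow-uMul zero    p e = trans (dP-uMul p e) (cong (λ z → uMul (dP p) e + z) (sym (ℤP.*-identityˡ (p e))))
dPow-uMul (suc i) p e = begin
  dP (dPow (suc i) (uMul p)) e
    ≡⟨ dP-cong (dPow-uMul i p) e ⟩
  dP (λ x → uMul (dPow (suc i) p) x + (+ suc i) * dPow i p x) e
    ≡⟨ dPow-+ 1 (uMul (dPow (suc i) p)) (λ x → (+ suc i) * dPow i p x) e ⟩
  dP (uMul (dPow (suc i) p)) e + dP (λ x → (+ suc i) * dPow i p x) e
    ≡⟨ cong₂ _+_ (dP-uMul (dPow (suc i) p) e) (dPow-* 1 (+ suc i) (dPow i p) e) ⟩
  (uMul (dPow (suc (suc i)) p) e + dPow (suc i) p e) + (+ suc i) * dPow (suc i) p e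
    ≡⟨ collect (uMul (dPow (suc (suc i)) p) e) (dPow (suc i) p e) (+ i) ⟩
  uMul (dPow (suc (suc i)) p) e + (+ suc (suc i)) * dPow (suc i) p e
    ∎
  where open ≡-Reasoning
        collect : ∀ a b n → (a + b) + (+ 1 + n) * b ≡ a + (+ 1 + (+ 1 + n)) * b
        collect = solve-∀

-- The formal adjoint

sign : ℕ → ℤ
sign n = (- (+ 1)) ^ n

-- Coefficient of D^j in the formal adjoint  Σ_n (-D)^n ∘ a_n  of  A = Σ_n a_n D^n,
-- keeping the summands n = j + i with i < K (all of them when A has order < K).
adjointTerm : Op → ℕ → ℕ → ℤ → ℤ
adjointTerm A j i e = sign (j ℕ.+ i) * (+ binom (j ℕ.+ i) j) * dPow i (A (j ℕ.+ i)) e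

adjoint : ℕ → Op → Op
adjoint K A j e = sumTo K (λ i → adjointTerm A j i e)

adjointTerm-vanishes : ∀ {K A} → Order< K A → ∀ j i e → K ≤ j ℕ.+ i → adjointTerm A j i e ≡ + 0
adjointTerm-vanishes {K} {A} z j i e K≤j+i =
  trans (cong (sign (j ℕ.+ i) * + binom (j ℕ.+ i) j *_) (dPow-zero i (A (j ℕ.+ i)) (λ x → z (j ℕ.+ i) x K≤j+i) e))
        (ℤP.*-zeroʳ (sign (j ℕ.+ i) * + binom (j ℕ.+ i) j))

adjoint-extend : ∀ K L A → Order< K A → K ≤ L → adjoint L A ≈ adjoint K A
adjoint-extend K L A z K≤L j e =
  sumTo-extend K L (λ i → adjointTerm A j i e)
    (λ i K≤i → adjointTerm-vanishes z j i e (ℕP.≤-trans K≤i (ℕP.m≤n+m i j))) K≤L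

adjoint-cong : ∀ K {A B} → A ≈ B → adjoint K A ≈ adjoint K B
adjoint-cong K h j e =
  sumTo-cong K (λ i → cong (sign (j ℕ.+ i) * + binom (j ℕ.+ i) j *_) (dPow-cong i (h (j ℕ.+ i)) e))

adjoint-⊕ : ∀ K A B → adjoint K (A ⊕ B) ≈ (adjoint K A ⊕ adjoint K B)
adjoint-⊕ K A B j e = trans (sumTo-cong K termwise) (sumTo-+ K (λ i → adjointTerm A j i e) (λ i → adjointTerm B j i e))
  where
    termwise : ∀ i → adjointTerm (A ⊕ B) j i e ≡ adjointTerm A j i e + adjointTerm B j i e
    termwise i = trans (cong (sign (j ℕ.+ i) * + binom (j ℕ.+ i) j *_) (dPow-+ i (A (j ℕ.+ i)) (B (j ℕ.+ i)) e))
                       (ℤP.*-distribˡ-+ (sign (j ℕ.+ i) * + binom (j ℕ.+ i) j) _ _)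

adjoint-⊙ : ∀ K c A → adjoint K (c ⊙ A) ≈ (c ⊙ adjoint K A)
adjoint-⊙ K c A j e = trans (sumTo-cong K termwise) (sumTo-* K c (λ i → adjointTerm A j i e))
  where
    termwise : ∀ i → adjointTerm (c ⊙ A) j i e ≡ c * adjointTerm A j i e
    termwise i = trans (cong (sign (j ℕ.+ i) * + binom (j ℕ.+ i) j *_) (dPow-* i c (A (j ℕ.+ i)) e))
                       (x∙yz≈y∙xz (sign (j ℕ.+ i) * + binom (j ℕ.+ i) j) c _)

adjoint-zeroOp : ∀ K → adjoint K zeroOp ≈ zeroOp
adjoint-zeroOp K j e = sumTo-zero K _ (λ i → adjointTerm-vanishes (Order<-zeroOp 0) j i e z≤n)

adjoint-monomial : ∀ s → adjoint 1 (monomial s) ≈ monomial s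
adjoint-monomial s zero    e = unit (monomial s zero e)
  where unit : ∀ x → + 1 * + 1 * x + + 0 ≡ x
        unit = solve-∀
adjoint-monomial s (suc j) e = zeros (sign (suc (j ℕ.+ 0))) (+ binom (suc (j ℕ.+ 0)) (suc j))
  where zeros : ∀ a b → a * b * + 0 + + 0 ≡ + 0
        zeros = solve-∀

-- (ϑ̂ A)^* = A^* ∘ ϑ̂^*, and ϑ̂^* = (D u)^* = - u D.
module _ (K : ℕ) (A : Op) (order : Order< K A) where

  private
    open ≡-Reasoning

    -- ϑOp A (suc n) = u a_n + D (u a_(n+1)), definitionally
    dPow-ϑOp-suc : ∀ e i n → dPow i (ϑOp A (suc n)) e ≡ dPow i (uMul (A n)) e + dPow (suc i) (uMul (A (suc n))) e
    dPow-ϑOp-suc e i n =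
      trans (dPow-cong i {q = λ x → uMul (A n) x + dP (uMul (A (suc n))) x} (λ _ → refl) e)
            (trans (dPow-+ i (uMul (A n)) (dP (uMul (A (suc n)))) e)
                   (cong (λ z → dPow i (uMul (A n)) e + z) (dPow-dP i (uMul (A (suc n))) e)))

  adjoint-ϑOp-zero : ∀ e → adjoint (suc K) (ϑOp A) 0 e ≡ - (adjoint K A ·uD) 0 e
  adjoint-ϑOp-zero e = begin
    adjointTerm (ϑOp A) 0 0 e + sumTo K (λ i → adjointTerm (ϑOp A) 0 (suc i) e)
      ≡⟨ cong₂ _+_ (unit (dP (uMul (A 0)) e)) (sumTo-cong K difference) ⟩
    V 0 + sumTo K (λ i → V (suc i) - V i)
      ≡⟨ cong (λ z → V 0 + z) (sumTo-telescope K V) ⟩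
    V 0 + (V K - V 0)
      ≡⟨ cancel (V 0) (V K) ⟩
    V K
      ≡⟨ trans (cong (sign K *_) (dPow-zero (suc K) (uMul (A K)) (λ x → order K (x - + 1) ℕP.≤-refl) e)) (ℤP.*-zeroʳ (sign K)) ⟩
    + 0
      ∎
    where
      V : ℕ → ℤ
      V i = sign i * dPow (suc i) (uMul (A i)) e
      unit : ∀ x → + 1 * + 1 * x ≡ + 1 * x
      unit = solve-∀
      cancel : ∀ a b → a + (b - a) ≡ b
      cancel = solve-∀
      expand : ∀ s a b → (- + 1 * s) * + 1 * (a + b) ≡ (- + 1 * s) * b - s * a
      expand = solve-∀
      difference : ∀ i → adjointTerm (ϑOp A) 0 (suc i) e ≡ V (suc i) - V i
      difference i = trans (cong (sign (suc i) * + 1 *_) (dPow-ϑOp-suc e (suc i) i))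
                           (expand (sign i) (dPow (suc i) (uMul (A i)) e) (dPow (suc (suc i)) (uMul (A (suc i))) e))

  private
    module Suc (j : ℕ) (e : ℤ) where
      open ≡-Reasoning

      s : ℕ → ℤ
      s i = sign (j ℕ.+ i)

      V W : ℕ → ℤ
      V i = s i * + binom (j ℕ.+ i) (suc j) * dPow i (uMul (A (j ℕ.+ i))) e
      W i = s i * + binom (j ℕ.+ i) j * dPow i (uMul (A (j ℕ.+ i))) e

      -- Pascal's rule and  sign (n + 1) = - sign n
      term-split : ∀ i → adjointTerm (ϑOp A) (suc j) i e ≡ (V (suc i) - V i) + - W i
      term-split i = begin
        sign (suc (j ℕ.+ i)) * + binom (suc (j ℕ.+ i)) (suc j) * dPow i (ϑOp A (suc (j ℕ.+ i))) e
          ≡⟨ cong (sign (suc (j ℕ.+ i)) * + binom (suc (j ℕ.+ i)) (suc j) *_) (dPow-ϑOp-suc e i (j ℕ.+ i)) ⟩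
        (- + 1 * s i) * (+ binom (j ℕ.+ i) j + + binom (j ℕ.+ i) (suc j)) * (x + y)
          ≡⟨ expand (s i) (+ binom (j ℕ.+ i) j) (+ binom (j ℕ.+ i) (suc j)) x y ⟩
        ((- + 1 * s i) * (+ binom (j ℕ.+ i) j + + binom (j ℕ.+ i) (suc j)) * y - V i) + - W i
          ≡⟨ cong (λ z → (z - V i) + - W i) (sym V-suc) ⟩
        (V (suc i) - V i) + - W i
          ∎
        where
          x = dPow i (uMul (A (j ℕ.+ i))) e
          y = dPow (suc i) (uMul (A (suc (j ℕ.+ i)))) e
          expand : ∀ s b c x y → (- + 1 * s) * (b + c) * (x + y) ≡ ((- + 1 * s) * (b + c) * y - s * c * x) + - (s * b * x)
          expand = solve-∀
          V-suc : V (suc i) ≡ sign (suc (j ℕ.+ i)) * + binom (suc (j ℕ.+ i)) (suc j) * y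
          V-suc rewrite ℕP.+-suc j i = refl

      V-first : V 0 ≡ + 0
      V-first = begin
        s 0 * + binom (j ℕ.+ 0) (suc j) * dPow 0 (uMul (A (j ℕ.+ 0))) e
          ≡⟨ cong (λ b → s 0 * + b * dPow 0 (uMul (A (j ℕ.+ 0))) e) (binom-> (j ℕ.+ 0) (suc j) (s≤s (ℕP.≤-reflexive (ℕP.+-identityʳ j)))) ⟩
        s 0 * + 0 * dPow 0 (uMul (A (j ℕ.+ 0))) e
          ≡⟨ cong (_* dPow 0 (uMul (A (j ℕ.+ 0))) e) (ℤP.*-zeroʳ (s 0)) ⟩
        + 0
          ∎

      V-last : V (suc K) ≡ + 0
      V-last = trans (cong (s (suc K) * + binom (j ℕ.+ suc K) (suc j) *_) (dPow-zero (suc K) (uMul (A (j ℕ.+ suc K))) vanish e))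
                     (ℤP.*-zeroʳ (s (suc K) * + binom (j ℕ.+ suc K) (suc j)))
        where vanish : ∀ x → A (j ℕ.+ suc K) (x - + 1) ≡ + 0
              vanish x = order (j ℕ.+ suc K) (x - + 1) (ℕP.≤-trans (ℕP.n≤1+n K) (ℕP.m≤n+m (suc K) j))

      -- Leibniz:  D^i (u a) = u D^i a + i D^(i-1) a
      W₁ W₂ : ℕ → ℤ
      W₁ i = adjointTerm A j i (e - + 1)
      W₂ zero    = + 0
      W₂ (suc i) = s (suc i) * + binom (j ℕ.+ suc i) j * ((+ suc i) * dPow i (A (j ℕ.+ suc i)) e)

      leibniz : ∀ i → W i ≡ W₁ i + W₂ i
      leibniz zero    = sym (ℤP.+-identityʳ _)
      leibniz (suc i) = trans (cong (s (suc i) * + binom (j ℕ.+ suc i) j *_) (dPow-uMul i (A (j ℕ.+ suc i)) e))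
                              (ℤP.*-distribˡ-+ (s (suc i) * + binom (j ℕ.+ suc i) j) _ _)

      W₁-sum : sumTo (suc K) W₁ ≡ adjoint K A j (e - + 1)
      W₁-sum = sumTo-extend K (suc K) W₁
                 (λ i K≤i → adjointTerm-vanishes order j i (e - + 1) (ℕP.≤-trans K≤i (ℕP.m≤n+m i j))) (ℕP.n≤1+n K)

      W₂-suc : ∀ i → W₂ (suc i) ≡ (+ suc j) * adjointTerm A (suc j) i e
      W₂-suc i rewrite ℕP.+-suc j i = begin
        t * b * ((+ suc i) * d)                                ≡⟨ reassoc t b (+ suc i) d ⟩
        t * (b * + suc i) * d                                  ≡⟨ cong (λ z → t * z * d) absorb ⟩
        t * ((+ suc j) * + binom (suc (j ℕ.+ i)) (suc j)) * d  ≡⟨ pull t (+ suc j) (+ binom (suc (j ℕ.+ i)) (suc j)) d ⟩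
        (+ suc j) * (t * + binom (suc (j ℕ.+ i)) (suc j) * d)  ∎
        where
          t = sign (suc (j ℕ.+ i))
          b = + binom (suc (j ℕ.+ i)) j
          d = dPow i (A (suc (j ℕ.+ i))) e
          reassoc : ∀ s b n d → s * b * (n * d) ≡ s * (b * n) * d
          reassoc = solve-∀
          pull : ∀ s n b d → s * (n * b) * d ≡ n * (s * b * d)
          pull = solve-∀
          absorb : b * + suc i ≡ (+ suc j) * + binom (suc (j ℕ.+ i)) (suc j)
          absorb = trans (sym (ℤP.pos-* (binom (suc (j ℕ.+ i)) j) (suc i)))
                         (trans (cong +_ (binom-lower-step j i)) (ℤP.pos-* (suc j) _))

      W₂-sum : sumTo (suc K) W₂ ≡ (+ suc j) * adjoint K A (suc j) e
      W₂-sum = trans (ℤP.+-identityˡ _) (trans (sumTo-cong K W₂-suc) (sumTo-* K (+ suc j) (λ i → adjointTerm A (suc j) i e)))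

      W-sum : sumTo (suc K) W ≡ adjoint K A j (e - + 1) + (+ suc j) * adjoint K A (suc j) e
      W-sum = begin
        sumTo (suc K) W                        ≡⟨ sumTo-cong (suc K) leibniz ⟩
        sumTo (suc K) (λ i → W₁ i + W₂ i)      ≡⟨ sumTo-+ (suc K) W₁ W₂ ⟩
        sumTo (suc K) W₁ + sumTo (suc K) W₂    ≡⟨ cong₂ _+_ W₁-sum W₂-sum ⟩
        adjoint K A j (e - + 1) + (+ suc j) * adjoint K A (suc j) e ∎

  adjoint-ϑOp-suc : ∀ j e → adjoint (suc K) (ϑOp A) (suc j) e ≡ - (adjoint K A ·uD) (suc j) e
  adjoint-ϑOp-suc j e = begin
    sumTo (suc K) (λ i → adjointTerm (ϑOp A) (suc j) i e)
      ≡⟨ sumTo-cong (suc K) term-split ⟩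
    sumTo (suc K) (λ i → (V (suc i) - V i) + - W i)
      ≡⟨ sumTo-+ (suc K) (λ i → V (suc i) - V i) (λ i → - W i) ⟩
    sumTo (suc K) (λ i → V (suc i) - V i) + sumTo (suc K) (λ i → - W i)
      ≡⟨ cong₂ _+_ (sumTo-telescope (suc K) V) (sumTo-neg (suc K) W) ⟩
    (V (suc K) - V 0) + - sumTo (suc K) W
      ≡⟨ cong₂ (λ x y → (x - y) + - sumTo (suc K) W) V-last V-first ⟩
    (+ 0 - + 0) + - sumTo (suc K) W
      ≡⟨ cong (λ x → (+ 0 - + 0) + - x) W-sum ⟩
    (+ 0 - + 0) + - (adjoint K A j (e - + 1) + (+ suc j) * adjoint K A (suc j) e)
      ≡⟨ simplify _ ⟩
    - (adjoint K A j (e - + 1) + (+ suc j) * adjoint K A (suc j) e)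
      ∎
    where
      open ≡-Reasoning
      open Suc j e
      simplify : ∀ x → (+ 0 - + 0) + - x ≡ - x
      simplify = solve-∀

  adjoint-ϑOp : adjoint (suc K) (ϑOp A) ≈ (λ j e → - (adjoint K A ·uD) j e)
  adjoint-ϑOp zero    = adjoint-ϑOp-zero
  adjoint-ϑOp (suc j) = adjoint-ϑOp-suc j

-- Besides being the adjoint of X, X' satisfies X' ∘ uD = (ϑ̂ + d) ∘ X'; this is what lets the
-- adjoint of (ϑ̂ + c) ∘ X be computed from X' alone (IsAdjoint-ϑShift).
record IsAdjoint (K : ℕ) (d : ℤ) (X X' : Op) : Set where
  field
    order    : Order< K X
    adjoint≈ : adjoint K X ≈ X'
    ·uD≈     : (X' ·uD) ≈ ϑShift d X'

open IsAdjoint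

IsAdjoint-resp : ∀ {K d X X' Y'} → X' ≈ Y' → IsAdjoint K d X X' → IsAdjoint K d X Y'
IsAdjoint-resp {d = d} X'≈Y' a = record
  { order    = order a
  ; adjoint≈ = ≈-trans (adjoint≈ a) X'≈Y'
  ; ·uD≈     = ≈-trans (≈-cong ·uD-ϑLinear (≈-sym X'≈Y')) (≈-trans (·uD≈ a) (ϑShift-cong d X'≈Y'))
  }

IsAdjoint-monomial : ∀ s → IsAdjoint 1 (- (+ 1 + s)) (monomial s) (monomial s)
IsAdjoint-monomial s = record
  { order = Order<-monomial s ; adjoint≈ = adjoint-monomial s ; ·uD≈ = monomial-·uD s }

-- (ϑ̂ + c)^* = - u D + c, and  X' ∘ (- u D + c) = - (ϑ̂ + d - c) ∘ X'
IsAdjoint-ϑShift : ∀ {K d X X'} c → IsAdjoint K d X X' → IsAdjoint (suc K) d (ϑShift c X) ((- + 1) ⊙ ϑShift (d - c) X')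
IsAdjoint-ϑShift {K} {d} {X} {X'} c a = record
  { order    = Order<-ϑShift c (order a)
  ; adjoint≈ = adjoint-eq
  ; ·uD≈     = ·uD-eq
  }
  where
    adjoint-eq : adjoint (suc K) (ϑShift c X) ≈ ((- + 1) ⊙ ϑShift (d - c) X')
    adjoint-eq j e = begin
      adjoint (suc K) (ϑShift c X) j e
        ≡⟨ adjoint-⊕ (suc K) (ϑOp X) (c ⊙ X) j e ⟩
      adjoint (suc K) (ϑOp X) j e + adjoint (suc K) (c ⊙ X) j e
        ≡⟨ cong₂ _+_ (adjoint-ϑOp K X (order a) j e)
                     (trans (adjoint-⊙ (suc K) c X j e) (cong (c *_) (adjoint-extend K (suc K) X (order a) (ℕP.n≤1+n K) j e))) ⟩
      - (adjoint K X ·uD) j e + c * adjoint K X j e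
        ≡⟨ cong₂ (λ x y → - x + c * y) (trans (≈-cong ·uD-ϑLinear (adjoint≈ a) j e) (·uD≈ a j e)) (adjoint≈ a j e) ⟩
      - (ϑOp X' j e + d * X' j e) + c * X' j e
        ≡⟨ collect (X' j e) c (ϑOp X' j e) d ⟩
      - + 1 * (ϑOp X' j e + (d - c) * X' j e)
        ∎
      where open ≡-Reasoning
            collect : ∀ x c y d → - (y + d * x) + c * x ≡ - + 1 * (y + (d - c) * x)
            collect = solve-∀

    ·uD-eq : (((- + 1) ⊙ ϑShift (d - c) X') ·uD) ≈ ϑShift d ((- + 1) ⊙ ϑShift (d - c) X')
    ·uD-eq = begin
      (((- + 1) ⊙ ϑShift (d - c) X') ·uD)      ≈⟨ ⊙-homo ·uD-ϑLinear (- + 1) _ ⟩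
      (- + 1) ⊙ (ϑShift (d - c) X' ·uD)        ≈⟨ ⊙-cong (- + 1) (ϑShift-comm ·uD-ϑLinear (d - c) X') ⟩
      (- + 1) ⊙ ϑShift (d - c) (X' ·uD)        ≈⟨ ⊙-cong (- + 1) (ϑShift-cong (d - c) (·uD≈ a)) ⟩
      (- + 1) ⊙ ϑShift (d - c) (ϑShift d X')   ≈⟨ ⊙-cong (- + 1) (ϑShift-comm (ϑShift-ϑLinear (d - c)) d X') ⟩
      (- + 1) ⊙ ϑShift d (ϑShift (d - c) X')   ≈⟨ ϑShift-comm (⊙-ϑLinear (- + 1)) d _ ⟩
      ϑShift d ((- + 1) ⊙ ϑShift (d - c) X')   ∎
      where open ≈-Reasoning

IsAdjoint-ϑShiftPow : ∀ {K d X X'} c p → IsAdjoint K d X X' →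
                      IsAdjoint (p ℕ.+ K) d (ϑShiftPow c p X) (sign p ⊙ ϑShiftPow (d - c) p X')
IsAdjoint-ϑShiftPow {X' = X'} c zero    a = IsAdjoint-resp (≈-sym (⊙-identity X')) a
IsAdjoint-ϑShiftPow {d = d} {X' = X'} c (suc p) a =
  IsAdjoint-resp sign-out (IsAdjoint-ϑShift c (IsAdjoint-ϑShiftPow c p a))
  where
    sign-out : ((- + 1) ⊙ ϑShift (d - c) (sign p ⊙ ϑShiftPow (d - c) p X')) ≈ (sign (suc p) ⊙ ϑShiftPow (d - c) (suc p) X')
    sign-out = ≈-trans (⊙-cong (- + 1) (≈-sym (ϑShift-comm (⊙-ϑLinear (sign p)) (d - c) _))) (⊙-assoc (- + 1) (sign p) _)

-- Products of powers of shifted ϑ̂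

ϑProduct : ℕ → (ℕ → ℤ) → (ℕ → ℕ) → Op → Op
ϑProduct zero    c p X = X
ϑProduct (suc L) c p X = ϑShiftPow (c 0) (p 0) (ϑProduct L (λ i → c (suc i)) (λ i → p (suc i)) X)

totalPower : ℕ → (ℕ → ℕ) → ℕ
totalPower zero    p = 0
totalPower (suc L) p = p 0 ℕ.+ totalPower L (λ i → p (suc i))

ϑProduct-ϑLinear : ∀ L c p → ϑLinear (ϑProduct L c p)
ϑProduct-ϑLinear zero    c p = id-ϑLinear
ϑProduct-ϑLinear (suc L) c p = ∘-ϑLinear (ϑShiftPow-ϑLinear (c 0) (p 0)) (ϑProduct-ϑLinear L _ _)

ϑProduct-cong : ∀ L {c c' p p'} → (∀ i → i < L → c i ≡ c' i) → (∀ i → i < L → p i ≡ p' i) →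
                ∀ X → ϑProduct L c p X ≈ ϑProduct L c' p' X
ϑProduct-cong zero    hc hp X = ≈-refl
ϑProduct-cong (suc L) {c' = c'} {p' = p'} hc hp X rewrite hc 0 (s≤s z≤n) | hp 0 (s≤s z≤n) =
  ≈-cong (ϑShiftPow-ϑLinear (c' 0) (p' 0))
         (ϑProduct-cong L (λ i i<L → hc (suc i) (s≤s i<L)) (λ i i<L → hp (suc i) (s≤s i<L)) X)

ϑProduct-snoc : ∀ L c p X → ϑProduct (suc L) c p X ≈ ϑProduct L c p (ϑShiftPow (c L) (p L) X)
ϑProduct-snoc zero    c p X = ≈-refl
ϑProduct-snoc (suc L) c p X = ≈-cong (ϑShiftPow-ϑLinear (c 0) (p 0)) (ϑProduct-snoc L (λ i → c (suc i)) (λ i → p (suc i)) X)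

-- since the factors commute
ϑProduct-reverse : ∀ L c p X → ϑProduct L c p X ≈ ϑProduct L (λ i → c (L ∸ suc i)) (λ i → p (L ∸ suc i)) X
ϑProduct-reverse zero    c p X = ≈-refl
ϑProduct-reverse (suc L) c p X = begin
  ϑShiftPow (c 0) (p 0) (ϑProduct L c₊ p₊ X)
    ≈⟨ ≈-cong (ϑShiftPow-ϑLinear (c 0) (p 0)) (ϑProduct-reverse L c₊ p₊ X) ⟩
  ϑShiftPow (c 0) (p 0) (ϑProduct L (λ i → c₊ (L ∸ suc i)) (λ i → p₊ (L ∸ suc i)) X)
    ≈⟨ ϑShiftPow-comm (ϑProduct-ϑLinear L _ _) (c 0) (p 0) X ⟨
  ϑProduct L (λ i → c₊ (L ∸ suc i)) (λ i → p₊ (L ∸ suc i)) (ϑShiftPow (c 0) (p 0) X)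
    ≈⟨ ϑProduct-cong L (λ i i<L → cong c (index i i<L)) (λ i i<L → cong p (index i i<L)) _ ⟩
  ϑProduct L c⁻ p⁻ (ϑShiftPow (c 0) (p 0) X)
    ≈⟨ ≈-reflexive (cong (λ n → ϑProduct L c⁻ p⁻ (ϑShiftPow (c n) (p n) X)) (sym (ℕP.n∸n≡0 L))) ⟩
  ϑProduct L c⁻ p⁻ (ϑShiftPow (c⁻ L) (p⁻ L) X)
    ≈⟨ ϑProduct-snoc L c⁻ p⁻ X ⟨
  ϑProduct (suc L) c⁻ p⁻ X
    ∎
  where
    open ≈-Reasoning
    c₊ = λ i → c (suc i)
    p₊ = λ i → p (suc i)
    c⁻ = λ i → c (suc L ∸ suc i)
    p⁻ = λ i → p (suc L ∸ suc i)
    index : ∀ i → i < L → suc (L ∸ suc i) ≡ suc L ∸ suc i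
    index i i<L = sym (ℕP.+-∸-assoc 1 i<L)

IsAdjoint-ϑProduct : ∀ {K d X X'} L c p → IsAdjoint K d X X' →
                     IsAdjoint (totalPower L p ℕ.+ K) d (ϑProduct L c p X) (sign (totalPower L p) ⊙ ϑProduct L (λ i → d - c i) p X')
IsAdjoint-ϑProduct {X' = X'} zero c p a = IsAdjoint-resp (≈-sym (⊙-identity X')) a
IsAdjoint-ϑProduct {K} {d} {X} {X'} (suc L) c p a =
  subst (λ n → IsAdjoint n d (ϑProduct (suc L) c p X) (sign (totalPower (suc L) p) ⊙ ϑProduct (suc L) (λ i → d - c i) p X'))
        (sym (ℕP.+-assoc (p 0) P K))
        (IsAdjoint-resp sign-out (IsAdjoint-ϑShiftPow (c 0) (p 0) (IsAdjoint-ϑProduct L (λ i → c (suc i)) (λ i → p (suc i)) a)))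
  where
    P = totalPower L (λ i → p (suc i))
    Y = ϑProduct L (λ i → d - c (suc i)) (λ i → p (suc i)) X'
    sign-out : (sign (p 0) ⊙ ϑShiftPow (d - c 0) (p 0) (sign P ⊙ Y)) ≈ (sign (p 0 ℕ.+ P) ⊙ ϑShiftPow (d - c 0) (p 0) Y)
    sign-out = begin
      sign (p 0) ⊙ ϑShiftPow (d - c 0) (p 0) (sign P ⊙ Y)   ≈⟨ ⊙-cong (sign (p 0)) (≈-sym (ϑShiftPow-comm (⊙-ϑLinear (sign P)) (d - c 0) (p 0) Y)) ⟩
      sign (p 0) ⊙ (sign P ⊙ ϑShiftPow (d - c 0) (p 0) Y)   ≈⟨ ⊙-assoc (sign (p 0)) (sign P) _ ⟩
      (sign (p 0) * sign P) ⊙ ϑShiftPow (d - c 0) (p 0) Y   ≈⟨ (λ j e → cong (_* ϑShiftPow (d - c 0) (p 0) Y j e) (sym (ℤP.^-distribˡ-+-* (- + 1) (p 0) P))) ⟩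
      sign (p 0 ℕ.+ P) ⊙ ϑShiftPow (d - c 0) (p 0) Y        ∎
      where open ≈-Reasoning

uPow-ϑProduct : ∀ s L c p X → uPow s (ϑProduct L c p X) ≈ ϑProduct L (λ i → c i - s) p (uPow s X)
uPow-ϑProduct s zero    c p X = ≈-refl
uPow-ϑProduct s (suc L) c p X =
  ≈-trans (uPow-ϑShiftPow s (c 0) (p 0) _) (≈-cong (ϑShiftPow-ϑLinear (c 0 - s) (p 0)) (uPow-ϑProduct s L _ _ X))

module _ (s : ℤ) (L : ℕ) (c : ℕ → ℤ) (p : ℕ → ℕ) where

  private
    U : Op
    U = uPow s (ϑProduct L c p oneOp)

  -- The adjoint reverses the order of the factors and turns  ϑ̂ + c  into  ϑ̂ + s - 1 - c  past u^s.
  adjoint-uPow-ϑProduct : ∀ {P} → totalPower L p ≡ P →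
    Order< (suc P) U ×
    adjoint (suc P) U ≈ (sign P ⊙ uPow s (ϑProduct L (λ i → s - + 1 - c (L ∸ suc i)) (λ i → p (L ∸ suc i)) oneOp))
  adjoint-uPow-ϑProduct refl =
    Order<-cong (≈-sym U≈) (subst (λ n → Order< n (ϑProduct L (λ i → c i - s) p (monomial s))) P+1≡1+P (order product)) ,
    (begin
      adjoint (suc P) U
        ≈⟨ adjoint-cong (suc P) U≈ ⟩
      adjoint (suc P) (ϑProduct L (λ i → c i - s) p (monomial s))
        ≈⟨ ≈-reflexive (cong (λ n → adjoint n (ϑProduct L (λ i → c i - s) p (monomial s))) (sym P+1≡1+P)) ⟩
      adjoint (P ℕ.+ 1) (ϑProduct L (λ i → c i - s) p (monomial s))
        ≈⟨ adjoint≈ product ⟩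
      sign P ⊙ ϑProduct L (λ i → - (+ 1 + s) - (c i - s)) p (monomial s)
        ≈⟨ ⊙-cong (sign P) (ϑProduct-cong L (λ i _ → reshift (c i) s) (λ _ _ → refl) (monomial s)) ⟩
      sign P ⊙ ϑProduct L (λ i → (- + 1 - c i + s) - s) p (monomial s)
        ≈⟨ ⊙-cong (sign P) (uPow-ϑProduct s L (λ i → - + 1 - c i + s) p oneOp) ⟨
      sign P ⊙ uPow s (ϑProduct L (λ i → - + 1 - c i + s) p oneOp)
        ≈⟨ ⊙-cong (sign P) (uPow-cong s (ϑProduct-reverse L _ p oneOp)) ⟩
      sign P ⊙ uPow s (ϑProduct L (λ i → - + 1 - c (L ∸ suc i) + s) (λ i → p (L ∸ suc i)) oneOp)
        ≈⟨ ⊙-cong (sign P) (uPow-cong s (ϑProduct-cong L (λ i _ → reorder (c (L ∸ suc i)) s) (λ _ _ → refl) oneOp)) ⟩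
      sign P ⊙ uPow s (ϑProduct L (λ i → s - + 1 - c (L ∸ suc i)) (λ i → p (L ∸ suc i)) oneOp)
        ∎)
    where
      open ≈-Reasoning
      P = totalPower L p
      U≈ = uPow-ϑProduct s L c p oneOp
      product = IsAdjoint-ϑProduct L (λ i → c i - s) p (IsAdjoint-monomial s)
      P+1≡1+P : P ℕ.+ 1 ≡ suc P
      P+1≡1+P = ℕP.+-comm P 1
      reshift : ∀ c s → - (+ 1 + s) - (c - s) ≡ (- + 1 - c + s) - s
      reshift = solve-∀
      reorder : ∀ c s → - + 1 - c + s ≡ s - + 1 - c
      reorder = solve-∀

-- Tuples and their mirror images

-- out-of-range indices give 0
nth : List ℕ → ℕ → ℕ
nth []       i       = 0
nth (x ∷ xs) zero    = x
nth (x ∷ xs) (suc i) = nth xs i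

nth-++ˡ : ∀ l r i → i < length l → nth (l ++ r) i ≡ nth l i
nth-++ˡ (x ∷ l) r zero    _       = refl
nth-++ˡ (x ∷ l) r (suc i) (s≤s p) = nth-++ˡ l r i p

nth-++ʳ : ∀ l r j → nth (l ++ r) (length l ℕ.+ j) ≡ nth r j
nth-++ʳ []      r j = refl
nth-++ʳ (x ∷ l) r j = nth-++ʳ l r j

nth-length-++ : ∀ l r → nth (l ++ r) (length l) ≡ nth r 0
nth-length-++ l r = trans (cong (nth (l ++ r)) (sym (ℕP.+-identityʳ (length l)))) (nth-++ʳ l r 0)

nth-map : ∀ f l i → i < length l → nth (map f l) i ≡ f (nth l i)
nth-map f (x ∷ l) zero    _       = refl
nth-map f (x ∷ l) (suc i) (s≤s p) = nth-map f l i p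

nth-reverse : ∀ l i → i < length l → nth (reverse l) i ≡ nth l (length l ∸ suc i)
nth-reverse []      i ()
nth-reverse (x ∷ l) i p rewrite LP.unfold-reverse x l with ℕP.<-cmp i (length l)
... | tri< i<l _ _ =
  trans (nth-++ˡ (reverse l) (x ∷ []) i (subst (i <_) (sym (LP.length-reverse l)) i<l))
        (trans (nth-reverse l i i<l) (cong (nth (x ∷ l)) (sym (ℕP.+-∸-assoc 1 i<l))))
... | tri≈ _ refl _ =
  trans (cong (nth (reverse l ++ x ∷ [])) (sym (LP.length-reverse l)))
        (trans (nth-length-++ (reverse l) (x ∷ [])) (cong (nth (x ∷ l)) (sym (ℕP.n∸n≡0 (length l)))))
... | tri> _ _ i>l = ⊥-elim (ℕP.<⇒≱ i>l (ℕP.≤-pred p))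

nth-≤ : ∀ {M} l i → All (_≤ M) l → nth l i ≤ M
nth-≤ []      i       _        = z≤n
nth-≤ (x ∷ l) zero    (p ∷ _)  = p
nth-≤ (x ∷ l) (suc i) (_ ∷ ps) = nth-≤ l i ps

nth⇒All : ∀ {P : ℕ → Set} l → (∀ i → i < length l → P (nth l i)) → All P l
nth⇒All []      h = []
nth⇒All (a ∷ l) h = h 0 (s≤s z≤n) ∷ nth⇒All l (λ i p → h (suc i) (s≤s p))

∸-telescope : ∀ a b c → c ≤ b → b ≤ a → (a ∸ b) ℕ.+ (b ∸ c) ≡ a ∸ c
∸-telescope a       b       zero    _         b≤a       = ℕP.m∸n+n≡m b≤a
∸-telescope (suc a) (suc b) (suc c) (s≤s c≤b) (s≤s b≤a) = ∸-telescope a b c c≤b b≤a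

[M∸b]∸[M∸a]≡a∸b : ∀ M a b → a ≤ M → b ≤ M → (M ∸ b) ∸ (M ∸ a) ≡ a ∸ b
[M∸b]∸[M∸a]≡a∸b M       zero    b       _         b≤M       = trans (ℕP.m≤n⇒m∸n≡0 (ℕP.m∸n≤m M b)) (sym (ℕP.0∸n≡0 b))
[M∸b]∸[M∸a]≡a∸b M       (suc a) zero    a≤M       _         = ℕP.m∸[m∸n]≡n a≤M
[M∸b]∸[M∸a]≡a∸b (suc M) (suc a) (suc b) (s≤s a≤M) (s≤s b≤M) = [M∸b]∸[M∸a]≡a∸b M a b a≤M b≤M

-- a ↦ M ∸ a on [0, M] and the identity above M, which makes it an involution of ℕ
reflect : ℕ → ℕ → ℕ
reflect M a with a ℕ.≤? M
... | yes _ = M ∸ a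
... | no  _ = a

reflect-≤ : ∀ M a → a ≤ M → reflect M a ≡ M ∸ a
reflect-≤ M a a≤M with a ℕ.≤? M
... | yes _ = refl
... | no a≰M = ⊥-elim (a≰M a≤M)

reflect-involutive : ∀ M a → reflect M (reflect M a) ≡ a
reflect-involutive M a with a ℕ.≤? M
... | yes a≤M = trans (reflect-≤ M (M ∸ a) (ℕP.m∸n≤m M a)) (ℕP.m∸[m∸n]≡n a≤M)
... | no a≰M with a ℕ.≤? M
...   | yes a≤M = ⊥-elim (a≰M a≤M)
...   | no  _   = refl

mirror : ℕ → List ℕ → List ℕ
mirror M α = map (reflect M) (reverse α)

mirror-involutive : ∀ M α → mirror M (mirror M α) ≡ α
mirror-involutive M α = begin
  map (reflect M) (reverse (map (reflect M) (reverse α)))  ≡⟨ cong (map (reflect M)) (LP.reverse-map (reflect M) (reverse α)) ⟨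
  map (reflect M) (map (reflect M) (reverse (reverse α)))  ≡⟨ LP.map-∘ (reverse (reverse α)) ⟨
  map (λ a → reflect M (reflect M a)) (reverse (reverse α)) ≡⟨ LP.map-cong (reflect-involutive M) (reverse (reverse α)) ⟩
  map (λ a → a) (reverse (reverse α))                       ≡⟨ LP.map-id (reverse (reverse α)) ⟩
  reverse (reverse α)                                       ≡⟨ LP.reverse-involutive α ⟩
  α                                                         ∎
  where open ≡-Reasoning

mirror-injective : ∀ M {α β} → mirror M α ≡ mirror M β → α ≡ β
mirror-injective M {α} {β} eq = trans (sym (mirror-involutive M α)) (trans (cong (mirror M) eq) (mirror-involutive M β))

length-mirror : ∀ M α → length (mirror M α) ≡ length α
length-mirror M α = trans (LP.length-map (reflect M) (reverse α)) (LP.length-reverse α)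

nth-mirror : ∀ M α i → i < length α → nth α (length α ∸ suc i) ≤ M → nth (mirror M α) i ≡ M ∸ nth α (length α ∸ suc i)
nth-mirror M α i i<len bound =
  trans (nth-map (reflect M) (reverse α) i (subst (i <_) (sym (LP.length-reverse α)) i<len))
        (trans (cong (reflect M) (nth-reverse α i i<len)) (reflect-≤ M _ bound))

IsChain : ℕ → List ℕ → Set
IsChain b []       = ⊤
IsChain b (a ∷ as) = (1 ≤ a × a ≤ b) × IsChain (a ∸ 2) as

∈-chains⁻ : ∀ k b α → α ∈ chains k b → length α ≡ k × IsChain b α
∈-chains⁻ zero b .[] (here refl) = refl , tt
∈-chains⁻ (suc k) b α α∈
  with a , a∈ , α∈′ ← find (∈P.∈-concatMap⁻ (λ a → map (a ∷_) (chains k (a ∸ 2))) {xs = applyUpTo (1 ℕ.+_) b} α∈)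
  with β , β∈ , refl ← ∈P.∈-map⁻ (a ∷_) α∈′
  with i , i<b , refl ← ∈P.∈-applyUpTo⁻ (1 ℕ.+_) a∈
  with len , chain ← ∈-chains⁻ k (suc i ∸ 2) β β∈
  = cong suc len , (s≤s z≤n , i<b) , chain

∈-chains⁺ : ∀ k b α → length α ≡ k → IsChain b α → α ∈ chains k b
∈-chains⁺ zero    b []          refl _                      = here refl
∈-chains⁺ (suc k) b (suc a ∷ β) refl ((s≤s _ , a<b) , chain) =
  ∈P.∈-concatMap⁺ (λ x → map (x ∷_) (chains k (x ∸ 2))) {xs = applyUpTo (1 ℕ.+_) b}
    (lose (∈P.∈-applyUpTo⁺ (1 ℕ.+_) a<b) (∈P.∈-map⁺ (suc a ∷_) (∈-chains⁺ k (suc a ∸ 2) β refl chain)))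

1+m≤m+2 : ∀ m → suc m ≤ m ℕ.+ 2
1+m≤m+2 m = ℕP.≤-trans (ℕP.n≤1+n (suc m)) (ℕP.≤-reflexive (ℕP.+-comm 2 m))

[m+2]∸1≡1+m : ∀ m → m ℕ.+ 2 ∸ 1 ≡ suc m
[m+2]∸1≡1+m m = cong (_∸ 1) (ℕP.+-comm m 2)

[m+2]∸[1+m]≡1 : ∀ m → m ℕ.+ 2 ∸ suc m ≡ 1
[m+2]∸[1+m]≡1 m = trans (cong (_∸ suc m) (ℕP.+-comm m 2)) (ℕP.m+n∸n≡m 1 (suc m))

record IsChainᵢ (b : ℕ) (α : List ℕ) : Set where
  field
    positive : ∀ i → i < length α → 1 ≤ nth α i
    bounded  : ∀ i → i < length α → nth α i ≤ b
    gapped   : ∀ i → suc i < length α → nth α (suc i) ℕ.+ 2 ≤ nth α i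

open IsChainᵢ

IsChain⇒IsChainᵢ : ∀ b α → IsChain b α → IsChainᵢ b α
IsChain⇒IsChainᵢ b []       _                     = record { positive = λ _ () ; bounded = λ _ () ; gapped = λ _ () }
IsChain⇒IsChainᵢ b (a ∷ as) ((1≤a , a≤b) , chain) = record { positive = pos ; bounded = bnd ; gapped = gap }
  where
    tail = IsChain⇒IsChainᵢ (a ∸ 2) as chain
    pos : ∀ i → i < length (a ∷ as) → 1 ≤ nth (a ∷ as) i
    pos zero    _       = 1≤a
    pos (suc i) (s≤s p) = positive tail i p
    bnd : ∀ i → i < length (a ∷ as) → nth (a ∷ as) i ≤ b
    bnd zero    _       = a≤b
    bnd (suc i) (s≤s p) = ℕP.≤-trans (bounded tail i p) (ℕP.≤-trans (ℕP.m∸n≤m a 2) a≤b)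
    gap : ∀ i → suc i < length (a ∷ as) → nth (a ∷ as) (suc i) ℕ.+ 2 ≤ nth (a ∷ as) i
    gap zero    (s≤s p) = ≤∸2⇒+2≤ (positive tail 0 p) (bounded tail 0 p)
      where ≤∸2⇒+2≤ : ∀ {x a} → 1 ≤ x → x ≤ a ∸ 2 → x ℕ.+ 2 ≤ a
            ≤∸2⇒+2≤ {x}     {suc (suc a)} _ x≤a = subst (_≤ suc (suc a)) (ℕP.+-comm 2 x) (s≤s (s≤s x≤a))
            ≤∸2⇒+2≤ {suc x} {0}           _ ()
            ≤∸2⇒+2≤ {suc x} {1}           _ ()
    gap (suc i) (s≤s p) = gapped tail i p

nth-≤-head : ∀ α → (∀ i → suc i < length α → nth α (suc i) ℕ.+ 2 ≤ nth α i) → ∀ i → i < length α → nth α i ≤ nth α 0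
nth-≤-head α gaps zero    _ = ℕP.≤-refl
nth-≤-head α gaps (suc i) p =
  ℕP.≤-trans (ℕP.m≤m+n (nth α (suc i)) 2) (ℕP.≤-trans (gaps i p) (nth-≤-head α gaps i (ℕP.<-trans (ℕP.n<1+n i) p)))

IsChainᵢ⇒IsChain : ∀ b α → IsChainᵢ b α → IsChain b α
IsChainᵢ⇒IsChain b []       _     = tt
IsChainᵢ⇒IsChain b (a ∷ as) chain =
  (positive chain 0 (s≤s z≤n) , bounded chain 0 (s≤s z≤n)) , IsChainᵢ⇒IsChain (a ∸ 2) as tail
  where
    gaps : ∀ i → suc i < length as → nth as (suc i) ℕ.+ 2 ≤ nth as i
    gaps i p = gapped chain (suc i) (s≤s p)
    tail : IsChainᵢ (a ∸ 2) as
    tail = record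
      { positive = λ i p → positive chain (suc i) (s≤s p)
      ; bounded  = λ i p → ℕP.≤-trans (nth-≤-head as gaps i p)
                                      (ℕP.m+n≤o⇒m≤o∸n (nth as 0) (gapped chain 0 (s≤s (ℕP.≤-trans (s≤s z≤n) p))))
      ; gapped   = gaps
      }

module _ (m : ℕ) where

  private
    M : ℕ
    M = m ℕ.+ 2

    reflect-gap : ∀ x y → y ℕ.+ 2 ≤ x → x ≤ M → (M ∸ x) ℕ.+ 2 ≤ M ∸ y
    reflect-gap x y y+2≤x x≤M =
      subst ((M ∸ x) ℕ.+ 2 ≤_) (∸-telescope M x y (ℕP.m+n≤o⇒m≤o y y+2≤x) x≤M)
            (ℕP.+-monoʳ-≤ (M ∸ x) (ℕP.m+n≤o⇒m≤o∸n 2 (subst (_≤ x) (ℕP.+-comm y 2) y+2≤x)))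

  mirror-IsChainᵢ : ∀ α → IsChainᵢ (suc m) α → IsChainᵢ (suc m) (mirror M α)
  mirror-IsChainᵢ α chain = record { positive = pos ; bounded = bnd ; gapped = gap }
    where
      k = length α
      len : length (mirror M α) ≡ k
      len = length-mirror M α
      k∸[1+i]<k : ∀ i → i < k → k ∸ suc i < k
      k∸[1+i]<k i p = ℕP.∸-monoʳ-< {m = k} {n = suc i} {o = 0} (s≤s z≤n) p
      x : ℕ → ℕ
      x i = nth α (k ∸ suc i)
      entry : ∀ i → i < k → nth (mirror M α) i ≡ M ∸ x i
      entry i p = nth-mirror M α i p (ℕP.≤-trans (bounded chain (k ∸ suc i) (k∸[1+i]<k i p)) (1+m≤m+2 m))
      pos : ∀ i → i < length (mirror M α) → 1 ≤ nth (mirror M α) i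
      pos i p′ = let p = subst (i <_) len p′ in
        subst (1 ≤_) (sym (entry i p)) (subst (_≤ M ∸ x i) ([m+2]∸[1+m]≡1 m) (ℕP.∸-monoʳ-≤ M (bounded chain (k ∸ suc i) (k∸[1+i]<k i p))))
      bnd : ∀ i → i < length (mirror M α) → nth (mirror M α) i ≤ suc m
      bnd i p′ = let p = subst (i <_) len p′ in
        subst (_≤ suc m) (sym (entry i p)) (subst (M ∸ x i ≤_) ([m+2]∸1≡1+m m) (ℕP.∸-monoʳ-≤ M (positive chain (k ∸ suc i) (k∸[1+i]<k i p))))
      gap : ∀ i → suc i < length (mirror M α) → nth (mirror M α) (suc i) ℕ.+ 2 ≤ nth (mirror M α) i
      gap i p′ = subst₂ (λ u v → u ℕ.+ 2 ≤ v) (sym (entry (suc i) p))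
                        (sym (trans (entry i (ℕP.<-trans (ℕP.n<1+n i) p)) (cong (λ z → M ∸ nth α z) j≡)))
                        (reflect-gap (nth α j) (nth α (suc j)) (gapped chain j 1+j<k) (ℕP.≤-trans (bounded chain j j<k) (1+m≤m+2 m)))
        where
          p = subst (suc i <_) len p′
          j = k ∸ suc (suc i)
          j≡ : k ∸ suc i ≡ suc j
          j≡ = ℕP.+-∸-assoc 1 p
          1+j<k : suc j < k
          1+j<k = subst (_< k) j≡ (k∸[1+i]<k i (ℕP.<-trans (ℕP.n<1+n i) p))
          j<k : j < k
          j<k = ℕP.<-trans (ℕP.n<1+n j) 1+j<k

  mirror-∈-chains : ∀ k α → α ∈ chains k (suc m) → mirror M α ∈ chains k (suc m)
  mirror-∈-chains k α α∈ with len , chain ← ∈-chains⁻ k (suc m) α α∈ =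
    ∈-chains⁺ k (suc m) (mirror M α) (trans (length-mirror M α) len)
      (IsChainᵢ⇒IsChain (suc m) (mirror M α) (mirror-IsChainᵢ α (IsChain⇒IsChainᵢ (suc m) α chain)))

∈-chains⇒All≤ : ∀ k b α → α ∈ chains k b → All (_≤ b) α
∈-chains⇒All≤ k b α α∈ = nth⇒All α (bounded (IsChain⇒IsChainᵢ b α (proj₂ (∈-chains⁻ k b α α∈))))

-- (α_0, α_1, …, α_k, α_(k+1)) = (m + 1, α_1, …, α_k, 1)
padded : ℕ → List ℕ → List ℕ
padded m α = suc m ∷ (α ++ 1 ∷ [])

-- the exponent α_i - α_(i+1) of the i-th factor of a tuple term
gap : ℕ → List ℕ → ℕ → ℕ
gap m α i = nth (padded m α) i ∸ nth (padded m α) (suc i)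

length-padded : ∀ m α → length (padded m α) ≡ suc (suc (length α))
length-padded m α = cong suc (trans (LP.length-++ α) (ℕP.+-comm (length α) 1))

module _ (m : ℕ) where

  private
    M : ℕ
    M = m ℕ.+ 2

  padded-mirror : ∀ α → padded m (mirror M α) ≡ map (reflect M) (reverse (padded m α))
  padded-mirror α = sym (begin
    map g (reverse (suc m ∷ (α ++ 1 ∷ [])))       ≡⟨ cong (map g) (LP.unfold-reverse (suc m) (α ++ 1 ∷ [])) ⟩
    map g (reverse (α ++ 1 ∷ []) ++ suc m ∷ [])   ≡⟨ cong (λ z → map g (z ++ suc m ∷ [])) (LP.reverse-++ α (1 ∷ [])) ⟩
    map g ((1 ∷ reverse α) ++ suc m ∷ [])         ≡⟨ LP.map-++ g (1 ∷ reverse α) (suc m ∷ []) ⟩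
    g 1 ∷ (map g (reverse α) ++ g (suc m) ∷ [])   ≡⟨ cong₂ (λ x y → x ∷ (map g (reverse α) ++ y ∷ [])) g1 g[1+m] ⟩
    suc m ∷ (mirror M α ++ 1 ∷ [])                ∎)
    where
      open ≡-Reasoning
      g = reflect M
      g1 : g 1 ≡ suc m
      g1 = trans (reflect-≤ M 1 (ℕP.≤-trans (s≤s z≤n) (1+m≤m+2 m))) ([m+2]∸1≡1+m m)
      g[1+m] : g (suc m) ≡ 1
      g[1+m] = trans (reflect-≤ M (suc m) (1+m≤m+2 m)) ([m+2]∸[1+m]≡1 m)

  gap-mirror : ∀ α k → length α ≡ k → All (_≤ suc m) α → ∀ i → i ≤ k → gap m (mirror M α) i ≡ gap m α (k ∸ i)
  gap-mirror α k refl bounds i i≤k = begin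
    nth (padded m (mirror M α)) i ∸ nth (padded m (mirror M α)) (suc i)
      ≡⟨ cong₂ (λ u v → nth u i ∸ nth v (suc i)) (padded-mirror α) (padded-mirror α) ⟩
    nth (map g (reverse Sq)) i ∸ nth (map g (reverse Sq)) (suc i)
      ≡⟨ cong₂ _∸_ (entry i (ℕP.≤-trans (s≤s i≤k) (ℕP.n≤1+n _))) (entry (suc i) (s≤s (s≤s i≤k))) ⟩
    g (nth Sq (len ∸ suc i)) ∸ g (nth Sq (len ∸ suc (suc i)))
      ≡⟨ cong (λ u → g (nth Sq u) ∸ g (nth Sq (k ∸ i))) (ℕP.+-∸-assoc 1 i≤k) ⟩
    g (nth Sq (suc (k ∸ i))) ∸ g (nth Sq (k ∸ i))
      ≡⟨ cong₂ _∸_ (reflect-≤ M _ (nth-≤ Sq (suc (k ∸ i)) Sq≤M)) (reflect-≤ M _ (nth-≤ Sq (k ∸ i) Sq≤M)) ⟩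
    (M ∸ nth Sq (suc (k ∸ i))) ∸ (M ∸ nth Sq (k ∸ i))
      ≡⟨ [M∸b]∸[M∸a]≡a∸b M (nth Sq (k ∸ i)) (nth Sq (suc (k ∸ i))) (nth-≤ Sq (k ∸ i) Sq≤M) (nth-≤ Sq (suc (k ∸ i)) Sq≤M) ⟩
    nth Sq (k ∸ i) ∸ nth Sq (suc (k ∸ i))
      ∎
    where
      open ≡-Reasoning
      g = reflect M
      Sq = padded m α
      len = suc (suc (length α))
      Sq≤M : All (_≤ M) Sq
      Sq≤M = (1+m≤m+2 m) ∷ AllP.++⁺ (All.map (λ p → ℕP.≤-trans p (1+m≤m+2 m)) bounds) (ℕP.≤-trans (s≤s z≤n) (1+m≤m+2 m) ∷ [])
      entry : ∀ j → j < len → nth (map g (reverse Sq)) j ≡ g (nth Sq (len ∸ suc j))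
      entry j j<len =
        trans (nth-map g (reverse Sq) j (subst (j <_) (sym (trans (LP.length-reverse Sq) (length-padded m α))) j<len))
              (cong g (trans (nth-reverse Sq j (subst (j <_) (sym (length-padded m α)) j<len))
                             (cong (λ z → nth Sq (z ∸ suc j)) (length-padded m α))))

totalPower-differences : ∀ L (x : ℕ → ℕ) → (∀ i → i < L → x (suc i) ≤ x i) → totalPower L (λ i → x i ∸ x (suc i)) ≡ x 0 ∸ x L
totalPower-differences zero    x h = sym (ℕP.n∸n≡0 (x 0))
totalPower-differences (suc L) x h =
  trans (cong ((x 0 ∸ x 1) ℕ.+_) (totalPower-differences L (λ i → x (suc i)) (λ i p → h (suc i) (s≤s p))))
        (∸-telescope (x 0) (x 1) (x (suc L)) (last≤first L (λ i → x (suc i)) (λ i p → h (suc i) (s≤s p))) (h 0 (s≤s z≤n)))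
  where
    last≤first : ∀ L (x : ℕ → ℕ) → (∀ i → i < L → x (suc i) ≤ x i) → x L ≤ x 0
    last≤first zero    x h = ℕP.≤-refl
    last≤first (suc L) x h = ℕP.≤-trans (last≤first L (λ i → x (suc i)) (λ i p → h (suc i) (s≤s p))) (h 0 (s≤s z≤n))

totalPower-gap : ∀ m k α → α ∈ chains k (suc m) → totalPower (suc k) (gap m α) ≡ m
totalPower-gap m k α α∈ = trans (totalPower-differences (suc k) x descending) (cong (suc m ∸_) x[1+k]≡1)
  where
    x = nth (padded m α)
    len = proj₁ (∈-chains⁻ k (suc m) α α∈)
    chain = IsChain⇒IsChainᵢ (suc m) α (proj₂ (∈-chains⁻ k (suc m) α α∈))
    x[1+k]≡1 : x (suc k) ≡ 1
    x[1+k]≡1 = trans (cong (nth (α ++ 1 ∷ [])) (sym len)) (nth-length-++ α (1 ∷ []))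
    i<k : ∀ {i} → i < k → i < length α
    i<k {i} = subst (i <_) (sym len)
    descending : ∀ i → i < suc k → x (suc i) ≤ x i
    descending zero    _ = nth-≤ (α ++ 1 ∷ []) 0 (AllP.++⁺ (∈-chains⇒All≤ k (suc m) α α∈) (s≤s z≤n ∷ []))
    descending (suc i) (s≤s i<k′) with ℕP.<-cmp (suc i) k
    ... | tri< 1+i<k _ _ =
      subst₂ _≤_ (sym (nth-++ˡ α (1 ∷ []) (suc i) (i<k 1+i<k))) (sym (nth-++ˡ α (1 ∷ []) i (i<k i<k′)))
                 (ℕP.≤-trans (ℕP.m≤m+n (nth α (suc i)) 2) (gapped chain i (i<k 1+i<k)))
    ... | tri≈ _ refl _ =
      subst₂ _≤_ (sym x[1+k]≡1) (sym (nth-++ˡ α (1 ∷ []) i (i<k i<k′))) (positive chain i (i<k i<k′))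
    ... | tri> _ _ k<1+i = ⊥-elim (ℕP.<⇒≱ k<1+i i<k′)

concatMap-∷-unique : ∀ (L : ℕ → List (List ℕ)) as → Unique as → (∀ a → Unique (L a)) →
                     Unique (concatMap (λ a → map (a ∷_) (L a)) as)
concatMap-∷-unique L []       _          _      = []
concatMap-∷-unique L (a ∷ as) (a∉ ∷ uas) unique =
  Unique.++⁺ (Unique.map⁺ LP.∷-injectiveʳ (unique a)) (concatMap-∷-unique L as uas unique) disjoint
  where
    disjoint : ∀ {v} → ¬ (v ∈ map (a ∷_) (L a) × v ∈ concatMap (λ a → map (a ∷_) (L a)) as)
    disjoint (v∈₁ , v∈₂)
      with β , _ , refl ← ∈P.∈-map⁻ (a ∷_) v∈₁
      with a′ , a′∈ , v∈ ← find (∈P.∈-concatMap⁻ (λ a → map (a ∷_) (L a)) {xs = as} v∈₂)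
      with β′ , _ , eq ← ∈P.∈-map⁻ (a′ ∷_) v∈
      = AllP.All¬⇒¬Any a∉ (subst (_∈ as) (sym (LP.∷-injectiveˡ eq)) a′∈)

chains-unique : ∀ k b → Unique (chains k b)
chains-unique zero    b = [] ∷ []
chains-unique (suc k) b =
  concatMap-∷-unique (λ a → chains k (a ∸ 2)) (applyUpTo (1 ℕ.+_) b)
    (Unique.applyUpTo⁺₁ (1 ℕ.+_) b (λ i<j _ eq → ℕP.<⇒≢ i<j (ℕP.suc-injective eq)))
    (λ a → chains-unique k (a ∸ 2))

-- mirror is injective and maps chains onto chains, and chains has no duplicates
mirror-chains-↭ : ∀ m k → map (mirror (m ℕ.+ 2)) (chains k (suc m)) ↭ chains k (suc m)
mirror-chains-↭ m k =
  ∼bag⇒↭ (unique∧set⇒bag (Unique.map⁺ (mirror-injective M) (chains-unique k (suc m))) (chains-unique k (suc m))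
                          (λ {x} → mk⇔ (to x) (from x)))
  where
    M = m ℕ.+ 2
    to : ∀ x → x ∈ map (mirror M) (chains k (suc m)) → x ∈ chains k (suc m)
    to x x∈ with α , α∈ , refl ← ∈P.∈-map⁻ (mirror M) x∈ = mirror-∈-chains m k α α∈
    from : ∀ x → x ∈ chains k (suc m) → x ∈ map (mirror M) (chains k (suc m))
    from x x∈ = subst (_∈ map (mirror M) (chains k (suc m))) (mirror-involutive M x) (∈P.∈-map⁺ (mirror M) (mirror-∈-chains m k x x∈))

-- The inner sums of LOp m

sumOp-↭ : ∀ {xs ys : List Op} → xs ↭ ys → sumOp xs ≈ sumOp ys
sumOp-↭ ↭.refl         = ≈-refl
sumOp-↭ (↭.prep x p)   = ⊕-cong (≈-refl {x}) (sumOp-↭ p)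
sumOp-↭ {x ∷ y ∷ xs} {y ∷ x ∷ ys} (↭.swap x y p) j e =
  trans (cong (λ z → x j e + (y j e + z)) (sumOp-↭ p j e)) (+-x∙yz≈y∙xz (x j e) (y j e) (sumOp ys j e))
sumOp-↭ (↭.trans p q)  = ≈-trans (sumOp-↭ p) (sumOp-↭ q)

module _ {X : Set} where

  sumOp-map-cong : ∀ (xs : List X) f g → (∀ x → x ∈ xs → f x ≈ g x) → sumOp (map f xs) ≈ sumOp (map g xs)
  sumOp-map-cong []       f g h = ≈-refl
  sumOp-map-cong (x ∷ xs) f g h = ⊕-cong (h x (here refl)) (sumOp-map-cong xs f g (λ y y∈ → h y (there y∈)))

  Order<-sumOp-map : ∀ K (xs : List X) f → (∀ x → x ∈ xs → Order< K (f x)) → Order< K (sumOp (map f xs))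
  Order<-sumOp-map K []       f h = Order<-zeroOp K
  Order<-sumOp-map K (x ∷ xs) f h = Order<-⊕ (h x (here refl)) (Order<-sumOp-map K xs f (λ y y∈ → h y (there y∈)))

  uPow-sumOp-map : ∀ s (xs : List X) f → uPow s (sumOp (map f xs)) ≈ sumOp (map (λ x → uPow s (f x)) xs)
  uPow-sumOp-map s []       f = ≈-refl
  uPow-sumOp-map s (x ∷ xs) f = ⊕-cong (≈-refl {uPow s (f x)}) (uPow-sumOp-map s xs f)

  ⊙-sumOp-map : ∀ c (xs : List X) f → (c ⊙ sumOp (map f xs)) ≈ sumOp (map (λ x → c ⊙ f x) xs)
  ⊙-sumOp-map c []       f j e = ℤP.*-zeroʳ c
  ⊙-sumOp-map c (x ∷ xs) f j e =
    trans (ℤP.*-distribˡ-+ c (f x j e) _) (cong (λ z → c * f x j e + z) (⊙-sumOp-map c xs f j e))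

  adjoint-sumOp-map : ∀ K (xs : List X) f → adjoint K (sumOp (map f xs)) ≈ sumOp (map (λ x → adjoint K (f x)) xs)
  adjoint-sumOp-map K []       f = adjoint-zeroOp K
  adjoint-sumOp-map K (x ∷ xs) f =
    ≈-trans (adjoint-⊕ K (f x) (sumOp (map f xs))) (⊕-cong (≈-refl {adjoint K (f x)}) (adjoint-sumOp-map K xs f))

tupleCoefficient : ℕ → List ℕ → ℤ
tupleCoefficient m []       = + 1
tupleCoefficient m (a ∷ as) = (+ a * (+ a - + (m ℕ.+ 2))) * tupleCoefficient m as

differences : List ℕ → ℕ → ℕ
differences l i = nth l i ∸ nth l (suc i)

prodOp-ϑProduct : ∀ m k n a as X → prodOp m k n (a ∷ as) X ≈
  (tupleCoefficient m (a ∷ as) ⊙ ϑProduct (suc (length as)) (λ i → + (n ℕ.+ i) - + k) (differences ((a ∷ as) ++ 1 ∷ [])) X)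
prodOp-ϑProduct m k n a []       X j e =
  cong₂ _*_ (sym (ℤP.*-identityʳ (+ a * (+ a - + (m ℕ.+ 2))))) (cong (λ n′ → ϑShiftPow (+ n′ - + k) (a ∸ 1) X j e) (sym (ℕP.+-identityʳ n)))
prodOp-ϑProduct m k n a (b ∷ bs) X = begin
  cₐ ⊙ ϑShiftPow (+ n - + k) (a ∸ b) (prodOp m k (suc n) (b ∷ bs) X)
    ≈⟨ ⊙-cong cₐ (≈-cong (ϑShiftPow-ϑLinear (+ n - + k) (a ∸ b)) (prodOp-ϑProduct m k (suc n) b bs X)) ⟩
  cₐ ⊙ ϑShiftPow (+ n - + k) (a ∸ b) (c ⊙ Y)
    ≈⟨ ⊙-cong cₐ (ϑShiftPow-comm (⊙-ϑLinear c) (+ n - + k) (a ∸ b) Y) ⟨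
  cₐ ⊙ (c ⊙ ϑShiftPow (+ n - + k) (a ∸ b) Y)
    ≈⟨ ⊙-assoc cₐ c _ ⟩
  (cₐ * c) ⊙ ϑShiftPow (+ n - + k) (a ∸ b) Y
    ≈⟨ ⊙-cong (cₐ * c) (ϑProduct-cong (suc (suc (length bs))) {c = shift} {p = differences ((a ∷ b ∷ bs) ++ 1 ∷ [])} shifts (λ _ _ → refl) X) ⟩
  (cₐ * c) ⊙ ϑProduct (suc (suc (length bs))) (λ i → + (n ℕ.+ i) - + k) (differences ((a ∷ b ∷ bs) ++ 1 ∷ [])) X
    ∎
  where
    open ≈-Reasoning
    cₐ = + a * (+ a - + (m ℕ.+ 2))
    c = tupleCoefficient m (b ∷ bs)
    Y = ϑProduct (suc (length bs)) (λ i → + (suc n ℕ.+ i) - + k) (differences ((b ∷ bs) ++ 1 ∷ [])) X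
    shift : ℕ → ℤ
    shift zero    = + n - + k
    shift (suc i) = + (suc n ℕ.+ i) - + k
    shifts : ∀ i → i < suc (suc (length bs)) → shift i ≡ + (n ℕ.+ i) - + k
    shifts zero    _ = cong (λ n′ → + n′ - + k) (sym (ℕP.+-identityʳ n))
    shifts (suc i) _ = cong (λ n′ → + n′ - + k) (sym (ℕP.+-suc n i))

tupleOp-ϑProduct : ∀ m k α → length α ≡ suc k →
                   tupleOp m (suc k) α ≈ (tupleCoefficient m α ⊙ ϑProduct (suc (suc k)) (λ i → + i - + suc k) (gap m α) oneOp)
tupleOp-ϑProduct m k (a ∷ as) refl = begin
  ϑShiftPow (- + K) (suc m ∸ a) (prodOp m K 1 (a ∷ as) oneOp)
    ≈⟨ ≈-cong (ϑShiftPow-ϑLinear (- + K) (suc m ∸ a)) (prodOp-ϑProduct m K 1 a as oneOp) ⟩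
  ϑShiftPow (- + K) (suc m ∸ a) (c ⊙ Y)
    ≈⟨ ϑShiftPow-comm (⊙-ϑLinear c) (- + K) (suc m ∸ a) Y ⟨
  c ⊙ ϑShiftPow (- + K) (suc m ∸ a) Y
    ≈⟨ ⊙-cong c (ϑProduct-cong (suc K) {c = shift} {p = gap m (a ∷ as)} shifts (λ _ _ → refl) oneOp) ⟩
  c ⊙ ϑProduct (suc K) (λ i → + i - + K) (gap m (a ∷ as)) oneOp
    ∎
  where
    open ≈-Reasoning
    K = suc (length as)
    c = tupleCoefficient m (a ∷ as)
    Y = ϑProduct K (λ i → + (1 ℕ.+ i) - + K) (differences ((a ∷ as) ++ 1 ∷ [])) oneOp
    shift : ℕ → ℤ
    shift zero    = - + K
    shift (suc i) = + (suc i) - + K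
    shifts : ∀ i → i < suc K → shift i ≡ + i - + K
    shifts zero    _ = sym (ℤP.+-identityˡ (- + K))
    shifts (suc i) _ = refl

pos-∸ : ∀ {m n} → n ≤ m → + (m ∸ n) ≡ + m - + n
pos-∸ {m} {n} n≤m = trans (sym (ℤP.≤-⊖ n≤m)) (sym (ℤP.m-n≡m⊖n m n))

tupleCoefficient-++ : ∀ m l r → tupleCoefficient m (l ++ r) ≡ tupleCoefficient m l * tupleCoefficient m r
tupleCoefficient-++ m []      r = sym (ℤP.*-identityˡ (tupleCoefficient m r))
tupleCoefficient-++ m (a ∷ l) r =
  trans (cong ((+ a * (+ a - + (m ℕ.+ 2))) *_) (tupleCoefficient-++ m l r))
          (sym (ℤP.*-assoc (+ a * (+ a - + (m ℕ.+ 2))) (tupleCoefficient m l) (tupleCoefficient m r)))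

tupleCoefficient-reverse : ∀ m l → tupleCoefficient m (reverse l) ≡ tupleCoefficient m l
tupleCoefficient-reverse m []      = refl
tupleCoefficient-reverse m (a ∷ l) = begin
  tupleCoefficient m (reverse (a ∷ l))                       ≡⟨ cong (tupleCoefficient m) (LP.unfold-reverse a l) ⟩
  tupleCoefficient m (reverse l ++ a ∷ [])                   ≡⟨ tupleCoefficient-++ m (reverse l) (a ∷ []) ⟩
  tupleCoefficient m (reverse l) * tupleCoefficient m (a ∷ []) ≡⟨ cong (_* tupleCoefficient m (a ∷ [])) (tupleCoefficient-reverse m l) ⟩
  tupleCoefficient m l * (cₐ * + 1)                          ≡⟨ cong (tupleCoefficient m l *_) (ℤP.*-identityʳ cₐ) ⟩
  tupleCoefficient m l * cₐ                                  ≡⟨ ℤP.*-comm (tupleCoefficient m l) cₐ ⟩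
  cₐ * tupleCoefficient m l                                  ∎
  where open ≡-Reasoning
        cₐ = + a * (+ a - + (m ℕ.+ 2))

-- a (a - M) is invariant under a ↦ M - a
tupleCoefficient-map-reflect : ∀ m l → All (_≤ m ℕ.+ 2) l → tupleCoefficient m (map (reflect (m ℕ.+ 2)) l) ≡ tupleCoefficient m l
tupleCoefficient-map-reflect m []      _          = refl
tupleCoefficient-map-reflect m (a ∷ l) (a≤M ∷ l≤M) = cong₂ _*_ factor (tupleCoefficient-map-reflect m l l≤M)
  where
    M = m ℕ.+ 2
    symmetric : ∀ M a → (M - a) * ((M - a) - M) ≡ a * (a - M)
    symmetric = solve-∀
    factor : + reflect M a * (+ reflect M a - + M) ≡ + a * (+ a - + M)
    factor = trans (cong (λ z → z * (z - + M)) (trans (cong +_ (reflect-≤ M a a≤M)) (pos-∸ a≤M))) (symmetric (+ M) (+ a))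

tupleCoefficient-mirror : ∀ m α → All (_≤ m ℕ.+ 2) α → tupleCoefficient m (mirror (m ℕ.+ 2) α) ≡ tupleCoefficient m α
tupleCoefficient-mirror m α α≤M =
  trans (tupleCoefficient-map-reflect m (reverse α) (All-reverse α α≤M)) (tupleCoefficient-reverse m α)
  where
    All-reverse : ∀ {P : ℕ → Set} l → All P l → All P (reverse l)
    All-reverse []      []       = []
    All-reverse (a ∷ l) (p ∷ ps) rewrite LP.unfold-reverse a l = AllP.++⁺ (All-reverse l ps) (p ∷ [])

-- The k-th inner sum of LOp m, for k = suc k′.
module InnerSum (m k′ : ℕ) where

  private
    k : ℕ
    k = suc k′
    s : ℤ
    s = + 1 - + k
    M : ℕ
    M = m ℕ.+ 2

  term : List ℕ → Op
  term α = uPow s (tupleOp m k α)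

  term-adjoint : ∀ α → α ∈ chains k (suc m) →
                 Order< (suc m) (term α) × adjoint (suc m) (term α) ≈ (sign m ⊙ term (mirror M α))
  term-adjoint α α∈ =
    Order<-cong (≈-sym term≈) (Order<-⊙ c (proj₁ U-adjoint)) ,
    (begin
      adjoint (suc m) (term α)           ≈⟨ adjoint-cong (suc m) term≈ ⟩
      adjoint (suc m) (c ⊙ U α)          ≈⟨ adjoint-⊙ (suc m) c (U α) ⟩
      c ⊙ adjoint (suc m) (U α)          ≈⟨ ⊙-cong c (proj₂ U-adjoint) ⟩
      c ⊙ (sign m ⊙ U′)                  ≈⟨ ⊙-cong c (⊙-cong (sign m) (uPow-cong s reversed)) ⟩
      c ⊙ (sign m ⊙ U (mirror M α))      ≈⟨ ⊙-homo (⊙-ϑLinear c) (sign m) _ ⟩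
      sign m ⊙ (c ⊙ U (mirror M α))      ≈⟨ ⊙-cong (sign m) (λ j e → cong (_* U (mirror M α) j e) (sym c-mirror)) ⟩
      sign m ⊙ (c′ ⊙ U (mirror M α))     ≈⟨ ⊙-cong (sign m) (uPow-cong s (tupleOp-ϑProduct m k′ (mirror M α) len′)) ⟨
      sign m ⊙ term (mirror M α)         ∎)
    where
      open ≈-Reasoning
      len = proj₁ (∈-chains⁻ k (suc m) α α∈)
      len′ = trans (length-mirror M α) len
      α≤1+m = ∈-chains⇒All≤ k (suc m) α α∈
      c = tupleCoefficient m α
      c′ = tupleCoefficient m (mirror M α)
      c-mirror : c′ ≡ c
      c-mirror = tupleCoefficient-mirror m α (All.map (λ p → ℕP.≤-trans p (1+m≤m+2 m)) α≤1+m)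
      U : List ℕ → Op
      U β = uPow s (ϑProduct (suc k) (λ i → + i - + k) (gap m β) oneOp)
      term≈ : term α ≈ (c ⊙ U α)
      term≈ = uPow-cong s (tupleOp-ϑProduct m k′ α len)
      U′ : Op
      U′ = uPow s (ϑProduct (suc k) (λ i → s - + 1 - (+ (k ∸ i) - + k)) (λ i → gap m α (k ∸ i)) oneOp)
      U-adjoint = adjoint-uPow-ϑProduct s (suc k) (λ i → + i - + k) (gap m α) (totalPower-gap m k α α∈)
      shift : ∀ K i → (+ 1 - K) - + 1 - ((K - i) - K) ≡ i - K
      shift = solve-∀
      reversed : ϑProduct (suc k) (λ i → s - + 1 - (+ (k ∸ i) - + k)) (λ i → gap m α (k ∸ i)) oneOp
               ≈ ϑProduct (suc k) (λ i → + i - + k) (gap m (mirror M α)) oneOp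
      reversed = ϑProduct-cong (suc k)
        (λ i i<1+k → trans (cong (λ z → s - + 1 - (z - + k)) (pos-∸ (ℕP.≤-pred i<1+k))) (shift (+ k) (+ i)))
        (λ i i<1+k → sym (gap-mirror m α k len α≤1+m i (ℕP.≤-pred i<1+k)))
        oneOp

  innerSum : Op
  innerSum = uPow s (sumOp (map (tupleOp m k) (chains k (suc m))))

  private
    innerSum≈ : innerSum ≈ sumOp (map term (chains k (suc m)))
    innerSum≈ = uPow-sumOp-map s (chains k (suc m)) (tupleOp m k)

  innerSum-order : Order< (suc m) innerSum
  innerSum-order = Order<-cong (≈-sym innerSum≈) (Order<-sumOp-map (suc m) (chains k (suc m)) term (λ α α∈ → proj₁ (term-adjoint α α∈)))

  -- the summands are permuted by the mirror image of the tuples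
  innerSum-adjoint : adjoint (suc m) innerSum ≈ (sign m ⊙ innerSum)
  innerSum-adjoint = begin
    adjoint (suc m) innerSum
      ≈⟨ adjoint-cong (suc m) innerSum≈ ⟩
    adjoint (suc m) (sumOp (map term chs))
      ≈⟨ adjoint-sumOp-map (suc m) chs term ⟩
    sumOp (map (λ α → adjoint (suc m) (term α)) chs)
      ≈⟨ sumOp-map-cong chs _ _ (λ α α∈ → proj₂ (term-adjoint α α∈)) ⟩
    sumOp (map (λ α → sign m ⊙ term (mirror M α)) chs)
      ≈⟨ ⊙-sumOp-map (sign m) chs (λ α → term (mirror M α)) ⟨
    sign m ⊙ sumOp (map (λ α → term (mirror M α)) chs)
      ≈⟨ ⊙-cong (sign m) (≈-reflexive (cong sumOp (LP.map-∘ chs))) ⟩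
    sign m ⊙ sumOp (map term (map (mirror M) chs))
      ≈⟨ ⊙-cong (sign m) (sumOp-↭ (↭P.map⁺ term (mirror-chains-↭ m k))) ⟩
    sign m ⊙ sumOp (map term chs)
      ≈⟨ ⊙-cong (sign m) innerSum≈ ⟨
    sign m ⊙ innerSum
      ∎
    where
      open ≈-Reasoning
      chs = chains k (suc m)

module _ (m : ℕ) where

  private
    leading : Op
    leading = uPow (+ 1) (ϑShiftPow (+ 0) m oneOp)

    ks : List ℕ
    ks = fromTo 1 (suc (m ℕ./ 2))

    summand : ℕ → Op
    summand k = uPow (+ 1 - + k) (sumOp (map (tupleOp m k) (chains k (suc m))))

    leading-adjoint : Order< (suc m) leading × adjoint (suc m) leading ≈ (sign m ⊙ leading)
    leading-adjoint = adjoint-uPow-ϑProduct (+ 1) 1 (λ _ → + 0) (λ _ → m) (ℕP.+-identityʳ m)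

    summand-adjoint : ∀ k → k ∈ ks → Order< (suc m) (summand k) × adjoint (suc m) (summand k) ≈ (sign m ⊙ summand k)
    summand-adjoint k k∈ with i , _ , refl ← ∈P.∈-applyUpTo⁻ (1 ℕ.+_) k∈ =
      InnerSum.innerSum-order m i , InnerSum.innerSum-adjoint m i

  LOp-order : Order< (suc m) (LOp m)
  LOp-order = Order<-⊕ (proj₁ leading-adjoint) (Order<-sumOp-map (suc m) ks summand (λ k k∈ → proj₁ (summand-adjoint k k∈)))

  LOp-adjoint : adjoint (suc m) (LOp m) ≈ (sign m ⊙ LOp m)
  LOp-adjoint = begin
    adjoint (suc m) (leading ⊕ sumOp (map summand ks))
      ≈⟨ adjoint-⊕ (suc m) leading (sumOp (map summand ks)) ⟩
    adjoint (suc m) leading ⊕ adjoint (suc m) (sumOp (map summand ks))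
      ≈⟨ ⊕-cong (proj₂ leading-adjoint) (adjoint-sumOp-map (suc m) ks summand) ⟩
    (sign m ⊙ leading) ⊕ sumOp (map (λ k → adjoint (suc m) (summand k)) ks)
      ≈⟨ ⊕-cong (≈-refl {sign m ⊙ leading}) (sumOp-map-cong ks _ _ (λ k k∈ → proj₂ (summand-adjoint k k∈))) ⟩
    (sign m ⊙ leading) ⊕ sumOp (map (λ k → sign m ⊙ summand k) ks)
      ≈⟨ ⊕-cong (≈-refl {sign m ⊙ leading}) (⊙-sumOp-map (sign m) ks summand) ⟨
    (sign m ⊙ leading) ⊕ (sign m ⊙ sumOp (map summand ks))
      ≈⟨ ⊕-homo (⊙-ϑLinear (sign m)) leading _ ⟨
    sign m ⊙ LOp m
      ∎
    where open ≈-Reasoning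

  rhs≡adjoint : ∀ j → j ≤ m → ∀ e → rhs m j e ≡ adjoint (suc m) (LOp m) j e
  rhs≡adjoint j j≤m e = begin
    sumℤ (map f (fromTo j m))                         ≡⟨ sumℤ-applyUpTo (suc m ∸ j) f (j ℕ.+_) ⟩
    sumTo (suc m ∸ j) (λ i → f (j ℕ.+ i))             ≡⟨ sumTo-cong (suc m ∸ j) f≡adjointTerm ⟩
    sumTo (suc m ∸ j) (λ i → adjointTerm (LOp m) j i e) ≡⟨ sumTo-extend (suc m ∸ j) (suc m) _ vanish (ℕP.m∸n≤m (suc m) j) ⟨
    adjoint (suc m) (LOp m) j e                       ∎
    where
      open ≡-Reasoning
      f : ℕ → ℤ
      f n = ((- (+ 1)) ^ n) * (+ (n C j)) * dPow (n ∸ j) (ℓ m n) e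
      f≡adjointTerm : ∀ i → f (j ℕ.+ i) ≡ adjointTerm (LOp m) j i e
      f≡adjointTerm i rewrite sym (binom≡C (j ℕ.+ i) j) | ℕP.m+n∸m≡n j i = refl
      vanish : ∀ i → suc m ∸ j ≤ i → adjointTerm (LOp m) j i e ≡ + 0
      vanish i le = adjointTerm-vanishes LOp-order j i e
        (subst (_≤ j ℕ.+ i) (ℕP.m+[n∸m]≡n (ℕP.m≤n⇒m≤1+n j≤m)) (ℕP.+-monoʳ-≤ j le))

ℓ-self-adjoint : ∀ m j → j ≤ m → ∀ e → sign m * ℓ m j e ≡ rhs m j e
ℓ-self-adjoint m j j≤m e = sym (trans (rhs≡adjoint m j j≤m e) (LOp-adjoint m j e))

sign-involutive : ∀ j → sign j * sign j ≡ + 1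
sign-involutive zero    = refl
sign-involutive (suc j) = trans (square (sign j)) (sign-involutive j)
  where square : ∀ s → (- + 1 * s) * (- + 1 * s) ≡ s * s
        square = solve-∀

sign-injective : ∀ j {a b} → sign j * a ≡ sign j * b → a ≡ b
sign-injective j {a} {b} eq = begin
  a                      ≡⟨ ℤP.*-identityˡ a ⟨
  + 1 * a                ≡⟨ cong (_* a) (sign-involutive j) ⟨
  sign j * sign j * a    ≡⟨ ℤP.*-assoc (sign j) (sign j) a ⟩
  sign j * (sign j * a)  ≡⟨ cong (sign j *_) eq ⟩
  sign j * (sign j * b)  ≡⟨ ℤP.*-assoc (sign j) (sign j) b ⟨
  sign j * sign j * b    ≡⟨ cong (_* b) (sign-involutive j) ⟩
  + 1 * b                ≡⟨ ℤP.*-identityˡ b ⟩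
  b                      ∎
  where open ≡-Reasoning

-- Only the summands n = m - 1 and n = m of the adjoint survive in the coefficient of D^(m-1).
ℓ-subleading : ∀ j e → + 2 * ℓ (suc j) j e ≡ + suc j * dP (ℓ (suc j) (suc j)) e
ℓ-subleading j e = sym (sign-injective j (rearrange σ x (+ suc j) y top-two))
  where
    open ≡-Reasoning
    m = suc j
    x = ℓ m j e
    y = dP (ℓ m m) e
    σ = sign j
    beyond : ∀ i → 2 ≤ i → adjointTerm (LOp m) j i e ≡ + 0
    beyond i 2≤i = adjointTerm-vanishes (LOp-order m) j i e (subst (_≤ j ℕ.+ i) (ℕP.+-comm j 2) (ℕP.+-monoʳ-≤ j 2≤i))
    n=j : adjointTerm (LOp m) j 0 e ≡ σ * + 1 * x
    n=j rewrite ℕP.+-identityʳ j | binom-n-n j = refl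
    n=m : adjointTerm (LOp m) j 1 e ≡ (- + 1 * σ) * + m * y
    n=m rewrite ℕP.+-comm j 1 | binom-[1+n]-n j = refl
    top-two : (- + 1 * σ) * x ≡ σ * + 1 * x + ((- + 1 * σ) * + m * y + + 0)
    top-two = begin
      sign m * x                                            ≡⟨ LOp-adjoint m j e ⟨
      adjoint (suc m) (LOp m) j e                           ≡⟨ sumTo-extend 2 (suc m) _ beyond (s≤s (s≤s z≤n)) ⟩
      sumTo 2 (λ i → adjointTerm (LOp m) j i e)             ≡⟨ cong₂ (λ u v → u + (v + + 0)) n=j n=m ⟩
      σ * + 1 * x + ((- + 1 * σ) * + m * y + + 0)           ∎
    rearrange : ∀ s x M y → (- + 1 * s) * x ≡ s * + 1 * x + ((- + 1 * s) * M * y + + 0) → s * (M * y) ≡ s * (+ 2 * x)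
    rearrange s x M y eq = begin
      s * (M * y)                                                ≡⟨ isolate s x M y ⟩
      s * + 1 * x - (s * + 1 * x + ((- + 1 * s) * M * y + + 0))  ≡⟨ cong (λ z → s * + 1 * x - z) eq ⟨
      s * + 1 * x - (- + 1 * s) * x                              ≡⟨ double s x ⟩
      s * (+ 2 * x)                                              ∎
      where isolate : ∀ s x M y → s * (M * y) ≡ s * + 1 * x - (s * + 1 * x + ((- + 1 * s) * M * y + + 0))
            isolate = solve-∀
            double : ∀ s x → s * + 1 * x - (- + 1 * s) * x ≡ s * (+ 2 * x)
            double = solve-∀

2x≡My⇒x≡M/2*y : ∀ x y M → + 2 * x ≡ + M * y → x / 1 ≡ (+ M / 2) *ℚ (y / 1)
2x≡My⇒x≡M/2*y x y M eq = ℚP.toℚᵘ-injective (begin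
  toℚᵘ (x / 1)                      ≈⟨ ℚP.toℚᵘ-fromℚᵘ (mkℚᵘ x 0) ⟩
  mkℚᵘ x 0                          ≈⟨ *≡* cross ⟩
  mkℚᵘ (+ M) 1 ℚᵘ.* mkℚᵘ y 0        ≈⟨ ℚᵘP.*-cong (ℚP.toℚᵘ-fromℚᵘ (mkℚᵘ (+ M) 1)) (ℚP.toℚᵘ-fromℚᵘ (mkℚᵘ y 0)) ⟨
  toℚᵘ (+ M / 2) ℚᵘ.* toℚᵘ (y / 1)  ≈⟨ ℚP.toℚᵘ-homo-* (+ M / 2) (y / 1) ⟨
  toℚᵘ ((+ M / 2) *ℚ (y / 1))       ∎)
  where
    open ℚᵘP.≃-Reasoning
    cross : x * + 2 ≡ (+ M * y) * + 1
    cross = trans (ℤP.*-comm x (+ 2)) (trans eq (sym (ℤP.*-identityʳ (+ M * y))))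

corollary2p5 : (m : ℕ) → 2 ≤ m →
    ((j : ℕ) → j ≤ m → (e : ℤ) → ((- (+ 1)) ^ m) * ℓ m j e ≡ rhs m j e)
    × ((e : ℤ) → (ℓ m (m ∸ 1) e / 1) ≡ ((+ m) / 2) *ℚ (dP (ℓ m m) e / 1))
corollary2p5 (suc j) _ =
  ℓ-self-adjoint (suc j) ,
  λ e → 2x≡My⇒x≡M/2*y (ℓ (suc j) j e) (dP (ℓ (suc j) (suc j)) e) (suc j) (ℓ-subleading j e)
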